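{- Let $\beta=(1,\delta_1,1,\delta_2,\ldots,1,\delta_\ell)$ with $\delta_i$ positive integers, and let $\overline{F}(\beta)$ be the corresponding (narrow) circular fence. The map $\overline{\phi}$ defined below is a cardinality-preserving bijection from the set of lower order ideals of $\overline{F}(\beta)$ to the set of upper order ideals (filters) of $\overline{F}(\beta)$.
   Context: For a composition $\beta$ with an even number $2\ell$ of parts, summing to $n$, the fence $F(\beta)$ (obtained from chains $S_1,\dots,S_{2\ell}$ with $\#S_i=\beta_i+1$ by identifying maximal elements of $S_i,S_{i+1}$ for $i$ odd and minimal elements for $i$ even) has elements $x_1,\ldots,x_{n+1}$ from left to right; the circular fence $\overline{F}(\beta)$ is obtained by identifying $x_1$ and $x_{n+1}$. For $\beta=(1,\delta_1,\ldots,1,\delta_\ell)$, $\overline{F}(\beta)$ is the disjoint union of chains $D_1,\ldots,D_\ell$ (descending segments), $\#D_i=\delta_i+1$, with the additional cover relations that the minimum of $D_{i-1}$ is covered by the maximum of $D_i$ (indices mod $\ell$). Every lower order ideal is $\lfloor d\rfloor$, the union over $i$ of the $d_i$ smallest elements of $D_i$; every filter is $\lceil e\rceil$, the union of the $e_i$ largest elements of $D_i$. Define $\overline{\phi}(\lfloor d\rfloor)=\lceil e\rceil$ as follows. If all $d_i>0$, then $e=d$. Otherwise regard $d$ as a circular sequence (indices mod $\ell$, $d_\ell$ followed by $d_1$); a factor is a run of cyclically consecutive entries (viewed as a linear sequence), a block is a maximal factor of positive entries, the trailing ones $T$ of a block $B$ is its maximal (possibly empty) final segment consisting of ones, and $B'$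 is $B$ with $T$ removed. Then (P1) for each block with nonempty $T$, exchange $T$ with the entry $0$ cyclically immediately following it; (P2) for each block with $\#B'\ge2$, decrease the last entry of $B'$ by $1$ and increase the first entry of $B'$ by $1$; the result is $e$. -}

module Defs where

open import Data.Nat using (ℕ; zero; suc; _+_; _∸_; _≤_; _<_)
open import Data.Bool using (Bool; true; false; if_then_else_)
open import Data.Fin using (Fin; zero; suc; toℕ; fromℕ; inject₁)
open import Data.List using (List; []; _∷_; _++_; map; length; take; drop; reverse; replicate; allFin)
open import Data.Nat.ListAction using (sum)
open import Data.Maybe using (Maybe; just; nothing)
open import Data.Product using (Σ; _,_; _×_)
open import Relation.Binary.PropositionalEquality using (_≡_)
open import Relation.Binary.Construct.Closure.ReflexiveTransitive using (Star)
open import Relation.Nullary.Decidable using (⌊_⌋)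
open import Data.Nat using (_≤?_)

-- Elements: (i , j) with i : Fin ℓ indexing the descending segment D_i
-- and j : Fin (suc (δ i)) the height inside D_i
-- (j = 0 is the minimum of D_i, j = δ i its maximum), so #D_i = δ_i + 1.

Elem : (ℓ : ℕ) → (Fin ℓ → ℕ) → Set
Elem ℓ δ = Σ (Fin ℓ) (λ i → Fin (suc (δ i)))

prevC : ∀ {ℓ} → Fin ℓ → Fin ℓ
prevC {suc k} zero    = fromℕ k
prevC {suc k} (suc i) = inject₁ i

data Cover (ℓ : ℕ) (δ : Fin ℓ → ℕ) : Elem ℓ δ → Elem ℓ δ → Set where
  chain : (i : Fin ℓ) (j : Fin (δ i)) → Cover ℓ δ (i , inject₁ j) (i , suc j)
  link  : (i : Fin ℓ) → Cover ℓ δ (prevC i , zero) (i , fromℕ (δ i))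

Leq : (ℓ : ℕ) (δ : Fin ℓ → ℕ) → Elem ℓ δ → Elem ℓ δ → Set
Leq ℓ δ = Star (Cover ℓ δ)

Subset : (ℓ : ℕ) → (Fin ℓ → ℕ) → Set
Subset ℓ δ = Elem ℓ δ → Bool

IsLowerIdeal : (ℓ : ℕ) (δ : Fin ℓ → ℕ) → Subset ℓ δ → Set
IsLowerIdeal ℓ δ I = ∀ x y → Leq ℓ δ y x → I x ≡ true → I y ≡ true

IsFilter : (ℓ : ℕ) (δ : Fin ℓ → ℕ) → Subset ℓ δ → Set
IsFilter ℓ δ U = ∀ x y → Leq ℓ δ x y → U x ≡ true → U y ≡ true

countTrue : List Bool → ℕ
countTrue []            = 0
countTrue (true  ∷ bs)  = suc (countTrue bs)
countTrue (false ∷ bs)  = countTrue bs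

countIn : (ℓ : ℕ) (δ : Fin ℓ → ℕ) → Subset ℓ δ → Fin ℓ → ℕ
countIn ℓ δ S i = countTrue (map (λ j → S (i , j)) (allFin (suc (δ i))))

card : (ℓ : ℕ) (δ : Fin ℓ → ℕ) → Subset ℓ δ → ℕ
card ℓ δ S = sum (map (countIn ℓ δ S) (allFin ℓ))

decLast : List ℕ → List ℕ
decLast []           = []
decLast (x ∷ [])     = (x ∸ 1) ∷ []
decLast (x ∷ y ∷ zs) = x ∷ decLast (y ∷ zs)

p2 : List ℕ → List ℕ
p2 (x ∷ y ∷ zs) = suc x ∷ decLast (y ∷ zs)
p2 xs           = xs

leadOnes : List ℕ → ℕ
leadOnes (suc zero ∷ xs) = suc (leadOnes xs)
leadOnes _               = 0

dropOnes : List ℕ → List ℕ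
dropOnes (suc zero ∷ xs) = dropOnes xs
dropOnes xs              = xs

-- Given a block B (in reverse order, `racc`), which is followed by a 0,
-- produce (P2 B') ++ 0 ∷ T   (P1: T exchanged with the following 0).
emitBlock : List ℕ → List ℕ
emitBlock racc = p2 (reverse (dropOnes racc)) ++ (0 ∷ replicate (leadOnes racc) 1)

-- Process a linear sequence that ends with a 0 (so every block is
-- followed by a 0).  First argument: current block, reversed.
linProc : List ℕ → List ℕ → List ℕ
linProc []   []             = []
linProc racc []             = p2 (reverse (dropOnes racc)) ++ replicate (leadOnes racc) 1
linProc racc (zero  ∷ xs)   = emitBlock racc ++ linProc [] xs
linProc racc (suc x ∷ xs)   = linProc (suc x ∷ racc) xs

firstZero : List ℕ → Maybe ℕ
firstZero []           = nothing
firstZero (zero ∷ xs)  = just 0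
firstZero (suc _ ∷ xs) with firstZero xs
... | just k  = just (suc k)
... | nothing = nothing

rotL : ℕ → List ℕ → List ℕ
rotL r xs = drop r xs ++ take r xs

-- The map d ↦ e: identity if all entries positive; otherwise rotate so
-- that the sequence ends with a 0 (cyclic structure preserved), apply
-- P1 and P2 blockwise, and rotate back.
phiSeq : List ℕ → List ℕ
phiSeq d with firstZero d
... | nothing = d
... | just k  = rotL (length d ∸ suc k) (linProc [] (rotL (suc k) d))

nth : List ℕ → ℕ → ℕ
nth []       _       = 0
nth (x ∷ xs) zero    = x
nth (x ∷ xs) (suc n) = nth xs n

-- ⌈e⌉ : the union of the e_i largest elements of each D_i
ceilSet : (ℓ : ℕ) (δ : Fin ℓ → ℕ) → (Fin ℓ → ℕ) → Subset ℓ δ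
ceilSet ℓ δ e (i , j) = ⌊ suc (δ i) ≤? toℕ j + e i ⌋

-- ⌊d⌋ : the union of the d_i smallest elements of each D_i
floorSet : (ℓ : ℕ) (δ : Fin ℓ → ℕ) → (Fin ℓ → ℕ) → Subset ℓ δ
floorSet ℓ δ d (i , j) = ⌊ suc (toℕ j) ≤? d i ⌋

phiBar : (ℓ : ℕ) (δ : Fin ℓ → ℕ) → Subset ℓ δ → Subset ℓ δ
phiBar ℓ δ I = ceilSet ℓ δ e
  where
    d : List ℕ
    d = map (countIn ℓ δ I) (allFin ℓ)
    e : Fin ℓ → ℕ
    e i = nth (phiSeq d) (toℕ i)

-- A lower ideal I is determined by its counts d_i = #(I ∩ D_i), and d is the count sequence of a
-- lower ideal exactly when d_i ≤ δ_i + 1 and d_(i-1) = 0 forces d_i ≤ δ_i; dually for filters.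
-- So everything happens on count sequences, where the map d ↦ e preserves the sum. Rotated to
-- end in a zero, d is a concatenation of units B′ 1ᵗ 0, and d ↦ e sends each to P2(B′) 0 1ᵗ.
-- Read backwards, these images are again units whose P2 restores B′, so reversing, applying
-- the map and reversing again inverts it. In the unit form a zero of e follows either an entry
-- 0 or 1, or the last entry of P2(B′); the latter is not full, being lowered by P2 when #B′ ≥ 2
-- and otherwise preceded by a zero of d. This is the filter condition for ⌈e⌉.
module Submission where

open import Data.Bool using (Bool; true; false)
open import Data.Empty using (⊥; ⊥-elim)
open import Data.Fin using (Fin; zero; suc; toℕ; fromℕ; inject₁)
open import Data.Fin.Properties using (toℕ-inject₁; toℕ-fromℕ)
open import Data.List using (List; []; _∷_; _++_; _∷ʳ_; map; length; take; drop; reverse; replicate; zip; tabulate; allFin)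
open import Data.List.Properties
  using ( ++-assoc; ++-identityʳ; length-++; length-replicate; length-reverse; length-take; length-tabulate
        ; map-tabulate; map-cong; tabulate-cong; reverse-++; reverse-involutive; reverse-injective
        ; unfold-reverse; ʳ++-defn; take++drop≡id; ∷-injective; ++-identityʳ-unique )
open import Data.List.Relation.Binary.Permutation.Propositional using (_↭_; ↭-refl; ↭-trans; ↭-sym)
open import Data.List.Relation.Binary.Permutation.Propositional.Properties using (∷↭∷ʳ; ↭-length; ↭-reverse; All-resp-↭)
open import Data.List.Relation.Unary.All as All using (All; []; _∷_)
open import Data.List.Relation.Unary.All.Properties using (++⁺; ++⁻ˡ; ++⁻ʳ; replicate⁺; tabulate⁺; tabulate⁻)
open import Data.List.Relation.Unary.Linked as Linked using (Linked; []; [-]; _∷_)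
open import Data.Maybe using (just; nothing)
open import Data.Nat using (ℕ; zero; suc; _+_; _*_; _∸_; _≤_; _<_; z≤n; s≤s; s≤s⁻¹; _≤?_)
open import Data.Nat.ListAction using (sum)
open import Data.Nat.ListAction.Properties using (sum-++; sum-↭)
open import Data.Nat.Properties
open import Data.Product using (Σ; ∃₂; _,_; _×_; proj₁; proj₂)
open import Data.Sum using (_⊎_; inj₁; inj₂)
open import Data.Unit using (⊤; tt)
open import Function using (_∘_; flip)
open import Relation.Binary.Construct.Closure.ReflexiveTransitive using (ε; _◅_)
open import Relation.Binary.PropositionalEquality
open import Relation.Nullary using (¬_; Dec; yes; no)
open import Relation.Nullary.Decidable using (⌊_⌋)

open import Defs

open ≡-Reasoning

private variable
  A B : Set

-- Rotating and zipping lists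

length-∷ʳ : (xs : List A) (x : A) → length (xs ∷ʳ x) ≡ suc (length xs)
length-∷ʳ xs x = trans (length-++ xs) (+-comm (length xs) 1)

rotate₁ : List A → List A
rotate₁ []       = []
rotate₁ (x ∷ xs) = xs ∷ʳ x

rotate : ℕ → List A → List A
rotate zero    xs = xs
rotate (suc k) xs = rotate k (rotate₁ xs)

rotate-↭ : (k : ℕ) (xs : List A) → rotate k xs ↭ xs
rotate-↭ zero    xs       = ↭-refl
rotate-↭ (suc k) []       = rotate-↭ k []
rotate-↭ (suc k) (x ∷ xs) = ↭-trans (rotate-↭ k (xs ∷ʳ x)) (↭-sym (∷↭∷ʳ x xs))

length-rotate : (k : ℕ) (xs : List A) → length (rotate k xs) ≡ length xs
length-rotate k xs = ↭-length (rotate-↭ k xs)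

rotate-[] : (k : ℕ) → rotate {A} k [] ≡ []
rotate-[] zero    = refl
rotate-[] (suc k) = rotate-[] k

rotate-+ : (a b : ℕ) (xs : List A) → rotate (a + b) xs ≡ rotate b (rotate a xs)
rotate-+ zero    b xs = refl
rotate-+ (suc a) b xs = rotate-+ a b (rotate₁ xs)

rotate-comm : (a b : ℕ) (xs : List A) → rotate a (rotate b xs) ≡ rotate b (rotate a xs)
rotate-comm a b xs = begin
  rotate a (rotate b xs) ≡⟨ rotate-+ b a xs ⟨
  rotate (b + a) xs      ≡⟨ cong (λ k → rotate k xs) (+-comm b a) ⟩
  rotate (a + b) xs      ≡⟨ rotate-+ a b xs ⟩
  rotate b (rotate a xs) ∎

rotate-++ : (xs ys : List A) → rotate (length xs) (xs ++ ys) ≡ ys ++ xs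
rotate-++ []       ys = sym (++-identityʳ ys)
rotate-++ (x ∷ xs) ys = begin
  rotate (length xs) ((xs ++ ys) ∷ʳ x) ≡⟨ cong (rotate (length xs)) (++-assoc xs ys (x ∷ [])) ⟩
  rotate (length xs) (xs ++ ys ∷ʳ x)   ≡⟨ rotate-++ xs (ys ∷ʳ x) ⟩
  (ys ∷ʳ x) ++ xs                       ≡⟨ ++-assoc ys (x ∷ []) xs ⟩
  ys ++ x ∷ xs                          ∎

rotate-length : (xs : List A) → rotate (length xs) xs ≡ xs
rotate-length xs = begin
  rotate (length xs) xs        ≡⟨ cong (rotate (length xs)) (++-identityʳ xs) ⟨
  rotate (length xs) (xs ++ []) ≡⟨ rotate-++ xs [] ⟩
  xs                            ∎

rotate-*-length : (k : ℕ) (xs : List A) → rotate (k * length xs) xs ≡ xs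
rotate-*-length zero    xs = refl
rotate-*-length (suc k) xs = begin
  rotate (length xs + k * length xs) xs        ≡⟨ rotate-+ (length xs) (k * length xs) xs ⟩
  rotate (k * length xs) (rotate (length xs) xs) ≡⟨ cong (rotate (k * length xs)) (rotate-length xs) ⟩
  rotate (k * length xs) xs                    ≡⟨ rotate-*-length k xs ⟩
  xs                                           ∎

-- Rotating by k and then by k (n - 1) is rotating by a multiple of the length n.
rotate-inverse : (k : ℕ) (xs : List A) → rotate (k * (length xs ∸ 1)) (rotate k xs) ≡ xs
rotate-inverse k []       = trans (cong (rotate (k * 0)) (rotate-[] k)) (rotate-[] (k * 0))
rotate-inverse k (x ∷ xs) = begin
  rotate (k * length xs) (rotate k (x ∷ xs)) ≡⟨ rotate-+ k (k * length xs) (x ∷ xs) ⟨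
  rotate (k + k * length xs) (x ∷ xs)        ≡⟨ cong (λ m → rotate m (x ∷ xs)) (*-suc k (length xs)) ⟨
  rotate (k * length (x ∷ xs)) (x ∷ xs)      ≡⟨ rotate-*-length k (x ∷ xs) ⟩
  x ∷ xs                                     ∎

rotate-conjugate : (xs ws ys : List A) → xs ++ ws ≡ ws ++ ys → rotate (length ws) xs ≡ ys
rotate-conjugate xs       []       ys eq = trans (sym (++-identityʳ xs)) eq
rotate-conjugate []       (w ∷ ws) ys eq = trans (rotate-[] (length (w ∷ ws))) (sym (++-identityʳ-unique (w ∷ ws) eq))
rotate-conjugate (x ∷ xs) (w ∷ ws) ys eq with ∷-injective eq
... | refl , eq′ = rotate-conjugate (xs ∷ʳ x) ws ys (trans (++-assoc xs (x ∷ []) ws) eq′)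

reverse-rotate₁ : (xs : List A) → reverse (rotate₁ xs) ≡ rotate (length xs ∸ 1) (reverse xs)
reverse-rotate₁ []       = refl
reverse-rotate₁ (x ∷ xs) = begin
  reverse (xs ∷ʳ x)                              ≡⟨ reverse-++ xs (x ∷ []) ⟩
  x ∷ reverse xs                                 ≡⟨ rotate-++ (reverse xs) (x ∷ []) ⟨
  rotate (length (reverse xs)) (reverse xs ∷ʳ x) ≡⟨ cong₂ rotate (length-reverse xs) (sym (unfold-reverse x xs)) ⟩
  rotate (length xs) (reverse (x ∷ xs))          ∎

reverse-rotate : (k : ℕ) (xs : List A) → reverse (rotate k xs) ≡ rotate (k * (length xs ∸ 1)) (reverse xs)
reverse-rotate zero    xs = refl
reverse-rotate (suc k) xs = begin
  reverse (rotate k (rotate₁ xs))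
    ≡⟨ reverse-rotate k (rotate₁ xs) ⟩
  rotate (k * (length (rotate₁ xs) ∸ 1)) (reverse (rotate₁ xs))
    ≡⟨ cong₂ (λ n ys → rotate (k * (n ∸ 1)) ys) (length-rotate 1 xs) (reverse-rotate₁ xs) ⟩
  rotate (k * (length xs ∸ 1)) (rotate (length xs ∸ 1) (reverse xs))
    ≡⟨ rotate-+ (length xs ∸ 1) (k * (length xs ∸ 1)) (reverse xs) ⟨
  rotate (suc k * (length xs ∸ 1)) (reverse xs)
    ∎

rotL≡rotate : (n : ℕ) (xs : List ℕ) → n ≤ length xs → rotL n xs ≡ rotate n xs
rotL≡rotate n xs n≤ = begin
  drop n xs ++ take n xs                         ≡⟨ rotate-++ (take n xs) (drop n xs) ⟨
  rotate (length (take n xs)) (take n xs ++ drop n xs) ≡⟨ cong₂ rotate (trans (length-take n xs) (m≤n⇒m⊓n≡m n≤)) (take++drop≡id n xs) ⟩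
  rotate n xs                                    ∎

zip-++ : (xs ys : List A) (us vs : List B) → length xs ≡ length us → zip (xs ++ ys) (us ++ vs) ≡ zip xs us ++ zip ys vs
zip-++ []       ys []       vs eq = refl
zip-++ (x ∷ xs) ys (u ∷ us) vs eq = cong ((x , u) ∷_) (zip-++ xs ys us vs (suc-injective eq))

zip-rotate : (k : ℕ) (xs : List A) (us : List B) → length xs ≡ length us → zip (rotate k xs) (rotate k us) ≡ rotate k (zip xs us)
zip-rotate zero    xs       us       eq = refl
zip-rotate (suc k) []       []       eq = zip-rotate k [] [] refl
zip-rotate (suc k) (x ∷ xs) (u ∷ us) eq = begin
  zip (rotate k (xs ∷ʳ x)) (rotate k (us ∷ʳ u)) ≡⟨ zip-rotate k (xs ∷ʳ x) (us ∷ʳ u) (trans (length-∷ʳ xs x) (trans eq (sym (length-∷ʳ us u)))) ⟩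
  rotate k (zip (xs ∷ʳ x) (us ∷ʳ u))             ≡⟨ cong (rotate k) (zip-++ xs (x ∷ []) us (u ∷ []) (suc-injective eq)) ⟩
  rotate k (zip xs us ∷ʳ (x , u))                ∎

zip-reverse : (xs : List A) (us : List B) → length xs ≡ length us → zip (reverse xs) (reverse us) ≡ reverse (zip xs us)
zip-reverse []       []       eq = refl
zip-reverse (x ∷ xs) (u ∷ us) eq = begin
  zip (reverse (x ∷ xs)) (reverse (u ∷ us))   ≡⟨ cong₂ zip (unfold-reverse x xs) (unfold-reverse u us) ⟩
  zip (reverse xs ∷ʳ x) (reverse us ∷ʳ u)     ≡⟨ zip-++ (reverse xs) (x ∷ []) (reverse us) (u ∷ []) lengths ⟩
  zip (reverse xs) (reverse us) ∷ʳ (x , u)    ≡⟨ cong (_∷ʳ (x , u)) (zip-reverse xs us (suc-injective eq)) ⟩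
  reverse (zip xs us) ∷ʳ (x , u)              ≡⟨ unfold-reverse (x , u) (zip xs us) ⟨
  reverse (zip (x ∷ xs) (u ∷ us))             ∎
  where
  lengths : length (reverse xs) ≡ length (reverse us)
  lengths = trans (length-reverse xs) (trans (suc-injective eq) (sym (length-reverse us)))

zip-rotateˡ : (k : ℕ) (xs ys : List A) → length xs ≡ length ys →
              zip (rotate k xs) ys ≡ rotate k (zip xs (rotate (k * (length ys ∸ 1)) ys))
zip-rotateˡ k xs ys eq = begin
  zip (rotate k xs) ys                       ≡⟨ cong (zip (rotate k xs)) ys-rotated ⟨
  zip (rotate k xs) (rotate k (rotate m ys)) ≡⟨ zip-rotate k xs (rotate m ys) (trans eq (sym (length-rotate m ys))) ⟩
  rotate k (zip xs (rotate m ys))            ∎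
  where
  m : ℕ
  m = k * (length ys ∸ 1)
  ys-rotated : rotate k (rotate m ys) ≡ ys
  ys-rotated = trans (rotate-comm k m ys) (rotate-inverse k ys)

All-zip-proj₁ : {P : A → Set} (xs : List A) (ys : List B) → All P xs → All (P ∘ proj₁) (zip xs ys)
All-zip-proj₁ []       ys       _        = []
All-zip-proj₁ (x ∷ xs) []       _        = []
All-zip-proj₁ (x ∷ xs) (y ∷ ys) (p ∷ ps) = p ∷ All-zip-proj₁ xs ys ps

∷-∷ʳ-view : (y : A) (ys : List A) → ∃₂ λ zs x → y ∷ ys ≡ zs ∷ʳ x
∷-∷ʳ-view y []       = [] , y , refl
∷-∷ʳ-view y (z ∷ zs) with ∷-∷ʳ-view z zs
... | ws , x , eq = y ∷ ws , x , cong (y ∷_) eq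

∷ʳ-split : (cs : List A) (n : ℕ) → length cs ≡ suc n → ∃₂ λ cs′ c → cs ≡ cs′ ∷ʳ c × length cs′ ≡ n
∷ʳ-split (c ∷ cs) n eq with ∷-∷ʳ-view c cs
... | cs′ , c′ , split = cs′ , c′ , split , suc-injective (begin
  suc (length cs′)      ≡⟨ length-∷ʳ cs′ c′ ⟨
  length (cs′ ∷ʳ c′)    ≡⟨ cong length split ⟨
  length (c ∷ cs)       ≡⟨ eq ⟩
  suc n                 ∎)

zip-tabulate : {n : ℕ} (f : Fin n → A) (g : Fin n → B) → zip (tabulate f) (tabulate g) ≡ tabulate (λ i → f i , g i)
zip-tabulate {n = zero}  f g = refl
zip-tabulate {n = suc n} f g = cong ((f zero , g zero) ∷_) (zip-tabulate (f ∘ suc) (g ∘ suc))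

nth-tabulate : {n : ℕ} (f : Fin n → ℕ) (i : Fin n) → nth (tabulate f) (toℕ i) ≡ f i
nth-tabulate f zero    = refl
nth-tabulate f (suc i) = nth-tabulate (f ∘ suc) i

tabulate-nth : (n : ℕ) (xs : List ℕ) → length xs ≡ n → tabulate {n = n} (λ i → nth xs (toℕ i)) ≡ xs
tabulate-nth zero    []       _  = refl
tabulate-nth (suc n) (x ∷ xs) eq = cong (x ∷_) (tabulate-nth n xs (suc-injective eq))

-- Linked and cyclically linked lists

lastOr : A → List A → A
lastOr x []       = x
lastOr x (y ∷ ys) = lastOr y ys

lastOr-++ : (x : A) (xs ys : List A) → lastOr x (xs ++ ys) ≡ lastOr (lastOr x xs) ys
lastOr-++ x []       ys = refl
lastOr-++ x (y ∷ xs) ys = lastOr-++ y xs ys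

Cyclic : (A → A → Set) → List A → Set
Cyclic R []       = ⊤
Cyclic R (x ∷ xs) = Linked R (x ∷ xs ∷ʳ x)

module _ {R : A → A → Set} where

  Linked-++ : (x : A) (xs ys : List A) → Linked R (x ∷ xs) → Linked R (lastOr x xs ∷ ys) → Linked R (x ∷ xs ++ ys)
  Linked-++ x []       ys _        l  = l
  Linked-++ x (y ∷ xs) ys (r ∷ l₁) l₂ = r ∷ Linked-++ y xs ys l₁ l₂

  Linked-∷ʳ : (xs : List A) {y z : A} → Linked R (xs ∷ʳ y) → R y z → Linked R (xs ∷ʳ y ∷ʳ z)
  Linked-∷ʳ []            _         r = r ∷ [-]
  Linked-∷ʳ (x ∷ [])      (r₁ ∷ _) r = r₁ ∷ r ∷ [-]
  Linked-∷ʳ (x ∷ x′ ∷ xs) (r₁ ∷ l) r = r₁ ∷ Linked-∷ʳ (x′ ∷ xs) l r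

  Linked-++⁻ʳ : (xs : List A) {ys : List A} → Linked R (xs ++ ys) → Linked R ys
  Linked-++⁻ʳ []       l = l
  Linked-++⁻ʳ (x ∷ xs) l = Linked-++⁻ʳ xs (Linked.tail l)

  Cyclic-rotate₁ : (xs : List A) → Cyclic R xs → Cyclic R (rotate₁ xs)
  Cyclic-rotate₁ []           _       = tt
  Cyclic-rotate₁ (x ∷ [])     c       = c
  Cyclic-rotate₁ (x ∷ y ∷ ys) (r ∷ l) = Linked-∷ʳ (y ∷ ys) l r

  Cyclic-rotate : (k : ℕ) (xs : List A) → Cyclic R xs → Cyclic R (rotate k xs)
  Cyclic-rotate zero    xs c = c
  Cyclic-rotate (suc k) xs c = Cyclic-rotate k (rotate₁ xs) (Cyclic-rotate₁ xs c)

Linked-reverse : {R : A → A → Set} (xs : List A) → Linked R xs → Linked (flip R) (reverse xs)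
Linked-reverse         []           _       = []
Linked-reverse         (x ∷ [])     _       = [-]
Linked-reverse {R = R} (x ∷ y ∷ xs) (r ∷ l) = subst (Linked (flip R)) (sym reversed)
  (Linked-∷ʳ (reverse xs) (subst (Linked (flip R)) (unfold-reverse y xs) (Linked-reverse (y ∷ xs) l)) r)
  where
  reversed : reverse (x ∷ y ∷ xs) ≡ reverse xs ∷ʳ y ∷ʳ x
  reversed = trans (unfold-reverse x (y ∷ xs)) (cong (_∷ʳ x) (unfold-reverse y xs))

Cyclic-reverse : {R : A → A → Set} (xs : List A) → Cyclic R xs → Cyclic (flip R) (reverse xs)
Cyclic-reverse         []       _ = tt
Cyclic-reverse {R = R} (x ∷ xs) c = subst (Cyclic (flip R)) (sym (unfold-reverse x xs))
  (Cyclic-rotate₁ (x ∷ reverse xs) (subst (Linked (flip R)) reversed (Linked-reverse (x ∷ xs ∷ʳ x) c)))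
  where
  reversed : reverse (x ∷ xs ∷ʳ x) ≡ x ∷ reverse xs ∷ʳ x
  reversed = trans (unfold-reverse x (xs ∷ʳ x)) (cong (_∷ʳ x) (reverse-++ xs (x ∷ [])))

unrotate : (Q : List A → Set) → (∀ j xs → Q xs → Q (rotate j xs)) → ∀ k xs → Q (rotate k xs) → Q xs
unrotate Q rot k xs q = subst Q (rotate-inverse k xs) (rot (k * (length xs ∸ 1)) (rotate k xs) q)

module _ {R : A → A → Set} where

  Linked-tabulate-∷ʳ⁻ : (k : ℕ) (g : Fin (suc k) → A) (z : A) → Linked R (tabulate g ∷ʳ z) →
                        (∀ (i : Fin k) → R (g (inject₁ i)) (g (suc i))) × R (g (fromℕ k)) z
  Linked-tabulate-∷ʳ⁻ zero    g z (r ∷ _) = (λ ()) , r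
  Linked-tabulate-∷ʳ⁻ (suc k) g z (r ∷ l) with Linked-tabulate-∷ʳ⁻ k (g ∘ suc) z l
  ... | steps , last = (λ { zero → r ; (suc i) → steps i }) , last

  Linked-tabulate-∷ʳ⁺ : (k : ℕ) (g : Fin (suc k) → A) (z : A) →
                        (∀ (i : Fin k) → R (g (inject₁ i)) (g (suc i))) → R (g (fromℕ k)) z → Linked R (tabulate g ∷ʳ z)
  Linked-tabulate-∷ʳ⁺ zero    g z steps last = last ∷ [-]
  Linked-tabulate-∷ʳ⁺ (suc k) g z steps last = steps zero ∷ Linked-tabulate-∷ʳ⁺ k (g ∘ suc) z (steps ∘ suc) last

  Cyclic-tabulate⁻ : (k : ℕ) (g : Fin (suc k) → A) → Cyclic R (tabulate g) → ∀ i → R (g (prevC i)) (g i)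
  Cyclic-tabulate⁻ k g c zero    = proj₂ (Linked-tabulate-∷ʳ⁻ k g (g zero) c)
  Cyclic-tabulate⁻ k g c (suc i) = proj₁ (Linked-tabulate-∷ʳ⁻ k g (g zero) c) i

  Cyclic-tabulate⁺ : (k : ℕ) (g : Fin (suc k) → A) → (∀ i → R (g (prevC i)) (g i)) → Cyclic R (tabulate g)
  Cyclic-tabulate⁺ k g links = Linked-tabulate-∷ʳ⁺ k g (g zero) (links ∘ suc) (links zero)

-- Blocks and the linear pass

Positive : List ℕ → Set
Positive = All (1 ≤_)

Positive-reverse : {xs : List ℕ} → Positive xs → Positive (reverse xs)
Positive-reverse {xs} = All-resp-↭ (↭-sym (↭-reverse xs))

NoLeadingOne : List ℕ → Set
NoLeadingOne []                = ⊤
NoLeadingOne (zero ∷ _)        = ⊤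
NoLeadingOne (suc zero ∷ _)    = ⊥
NoLeadingOne (suc (suc _) ∷ _) = ⊤

reverse-∷-++ : (x : A) (xs ys : List A) → reverse (x ∷ xs) ++ ys ≡ reverse xs ++ x ∷ ys
reverse-∷-++ x xs ys = trans (sym (ʳ++-defn (x ∷ xs))) (ʳ++-defn xs)

reverse-replicate : (n : ℕ) (x : A) → reverse (replicate n x) ≡ replicate n x
reverse-replicate zero    x = refl
reverse-replicate (suc n) x = begin
  reverse (x ∷ replicate n x) ≡⟨ unfold-reverse x (replicate n x) ⟩
  reverse (replicate n x) ∷ʳ x ≡⟨ cong (_∷ʳ x) (reverse-replicate n x) ⟩
  replicate n x ∷ʳ x          ≡⟨ replicate-∷ʳ n ⟩
  x ∷ replicate n x           ∎
  where
  replicate-∷ʳ : (n : ℕ) → replicate n x ∷ʳ x ≡ x ∷ replicate n x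
  replicate-∷ʳ zero    = refl
  replicate-∷ʳ (suc n) = cong (x ∷_) (replicate-∷ʳ n)

leadOnes-dropOnes : (r : List ℕ) → replicate (leadOnes r) 1 ++ dropOnes r ≡ r
leadOnes-dropOnes []                = refl
leadOnes-dropOnes (zero ∷ r)        = refl
leadOnes-dropOnes (suc zero ∷ r)    = cong (1 ∷_) (leadOnes-dropOnes r)
leadOnes-dropOnes (suc (suc x) ∷ r) = refl

dropOnes-noLeadingOne : (r : List ℕ) → NoLeadingOne (dropOnes r)
dropOnes-noLeadingOne []                = tt
dropOnes-noLeadingOne (zero ∷ r)        = tt
dropOnes-noLeadingOne (suc zero ∷ r)    = dropOnes-noLeadingOne r
dropOnes-noLeadingOne (suc (suc x) ∷ r) = tt

dropOnes-positive : (r : List ℕ) → Positive r → Positive (dropOnes r)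
dropOnes-positive r pos = ++⁻ʳ (replicate (leadOnes r) 1) (subst Positive (sym (leadOnes-dropOnes r)) pos)

leadOnes-replicate : (t : ℕ) (r : List ℕ) → NoLeadingOne r → leadOnes (replicate t 1 ++ r) ≡ t
leadOnes-replicate (suc t) r h                 = cong suc (leadOnes-replicate t r h)
leadOnes-replicate zero    []                h = refl
leadOnes-replicate zero    (zero ∷ r)        h = refl
leadOnes-replicate zero    (suc (suc x) ∷ r) h = refl

dropOnes-replicate : (t : ℕ) (r : List ℕ) → NoLeadingOne r → dropOnes (replicate t 1 ++ r) ≡ r
dropOnes-replicate (suc t) r h                 = dropOnes-replicate t r h
dropOnes-replicate zero    []                h = refl
dropOnes-replicate zero    (zero ∷ r)        h = refl
dropOnes-replicate zero    (suc (suc x) ∷ r) h = refl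

-- linProc's first clause matches on racc, so linProc racc (x ∷ xs) only reduces once racc is split.
linProc-zero : (racc xs : List ℕ) → linProc racc (0 ∷ xs) ≡ emitBlock racc ++ linProc [] xs
linProc-zero []      xs = refl
linProc-zero (_ ∷ _) xs = refl

linProc-suc : (racc : List ℕ) (x : ℕ) (xs : List ℕ) → linProc racc (suc x ∷ xs) ≡ linProc (suc x ∷ racc) xs
linProc-suc []      x xs = refl
linProc-suc (_ ∷ _) x xs = refl

linProc-++ : (racc X Y : List ℕ) → linProc racc ((X ∷ʳ 0) ++ Y) ≡ linProc racc (X ∷ʳ 0) ++ linProc [] Y
linProc-++ racc [] Y = begin
  linProc racc (0 ∷ Y)                 ≡⟨ linProc-zero racc Y ⟩
  emitBlock racc ++ linProc [] Y        ≡⟨ cong (_++ linProc [] Y) (++-identityʳ (emitBlock racc)) ⟨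
  (emitBlock racc ++ []) ++ linProc [] Y ≡⟨ cong (_++ linProc [] Y) (linProc-zero racc []) ⟨
  linProc racc (0 ∷ []) ++ linProc [] Y ∎
linProc-++ racc (zero ∷ X) Y = begin
  linProc racc (0 ∷ (X ∷ʳ 0) ++ Y)                    ≡⟨ linProc-zero racc _ ⟩
  emitBlock racc ++ linProc [] ((X ∷ʳ 0) ++ Y)         ≡⟨ cong (emitBlock racc ++_) (linProc-++ [] X Y) ⟩
  emitBlock racc ++ linProc [] (X ∷ʳ 0) ++ linProc [] Y ≡⟨ ++-assoc (emitBlock racc) _ _ ⟨
  (emitBlock racc ++ linProc [] (X ∷ʳ 0)) ++ linProc [] Y ≡⟨ cong (_++ linProc [] Y) (linProc-zero racc _) ⟨
  linProc racc (0 ∷ X ∷ʳ 0) ++ linProc [] Y           ∎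
linProc-++ racc (suc x ∷ X) Y = begin
  linProc racc (suc x ∷ (X ∷ʳ 0) ++ Y)                ≡⟨ linProc-suc racc x _ ⟩
  linProc (suc x ∷ racc) ((X ∷ʳ 0) ++ Y)              ≡⟨ linProc-++ (suc x ∷ racc) X Y ⟩
  linProc (suc x ∷ racc) (X ∷ʳ 0) ++ linProc [] Y      ≡⟨ cong (_++ linProc [] Y) (linProc-suc racc x _) ⟨
  linProc racc (suc x ∷ X ∷ʳ 0) ++ linProc [] Y        ∎

linProc-block : (racc Z D : List ℕ) → Positive Z → linProc racc (Z ++ 0 ∷ D) ≡ emitBlock (reverse Z ++ racc) ++ linProc [] D
linProc-block racc []          D pos       = linProc-zero racc D
linProc-block racc (suc z ∷ Z) D (_ ∷ pos) = begin
  linProc racc (suc z ∷ Z ++ 0 ∷ D)                     ≡⟨ linProc-suc racc z _ ⟩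
  linProc (suc z ∷ racc) (Z ++ 0 ∷ D)                   ≡⟨ linProc-block (suc z ∷ racc) Z D pos ⟩
  emitBlock (reverse Z ++ suc z ∷ racc) ++ linProc [] D ≡⟨ cong (λ r → emitBlock r ++ linProc [] D) (reverse-∷-++ (suc z) Z racc) ⟨
  emitBlock (reverse (suc z ∷ Z) ++ racc) ++ linProc [] D ∎

-- A unit is a block B′ (here R = reverse B′, as linProc accumulates it)
-- followed by its t trailing ones and the zero that closes the block.
data Units : List ℕ → Set where
  []   : Units []
  unit : (R : List ℕ) (t : ℕ) {D : List ℕ} → Positive R → NoLeadingOne R → Units D →
         Units (reverse R ++ replicate t 1 ++ 0 ∷ D)

linProc-unit : (R : List ℕ) (t : ℕ) (D : List ℕ) → Positive R → NoLeadingOne R →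
               linProc [] (reverse R ++ replicate t 1 ++ 0 ∷ D) ≡ (p2 (reverse R) ++ 0 ∷ replicate t 1) ++ linProc [] D
linProc-unit R t D pos h = begin
  linProc [] (reverse R ++ replicate t 1 ++ 0 ∷ D)             ≡⟨ cong (linProc []) (++-assoc (reverse R) (replicate t 1) (0 ∷ D)) ⟨
  linProc [] ((reverse R ++ replicate t 1) ++ 0 ∷ D)           ≡⟨ linProc-block [] _ D (++⁺ (Positive-reverse pos) (replicate⁺ t (s≤s z≤n))) ⟩
  emitBlock (reverse (reverse R ++ replicate t 1) ++ []) ++ linProc [] D
    ≡⟨ cong (λ r → emitBlock r ++ linProc [] D) reversed ⟩
  emitBlock (replicate t 1 ++ R) ++ linProc [] D
    ≡⟨ cong₂ (λ r n → (p2 (reverse r) ++ 0 ∷ replicate n 1) ++ linProc [] D) (dropOnes-replicate t R h) (leadOnes-replicate t R h) ⟩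
  (p2 (reverse R) ++ 0 ∷ replicate t 1) ++ linProc [] D        ∎
  where
  reversed : reverse (reverse R ++ replicate t 1) ++ [] ≡ replicate t 1 ++ R
  reversed = begin
    reverse (reverse R ++ replicate t 1) ++ []       ≡⟨ ++-identityʳ _ ⟩
    reverse (reverse R ++ replicate t 1)             ≡⟨ reverse-++ (reverse R) (replicate t 1) ⟩
    reverse (replicate t 1) ++ reverse (reverse R)   ≡⟨ cong₂ _++_ (reverse-replicate t 1) (reverse-involutive R) ⟩
    replicate t 1 ++ R                               ∎

reverse-dropOnes-++ : (r ys : List ℕ) → reverse (dropOnes r) ++ replicate (leadOnes r) 1 ++ ys ≡ reverse r ++ ys
reverse-dropOnes-++ r ys = begin
  reverse (dropOnes r) ++ replicate (leadOnes r) 1 ++ ys           ≡⟨ ++-assoc (reverse (dropOnes r)) _ ys ⟨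
  (reverse (dropOnes r) ++ replicate (leadOnes r) 1) ++ ys         ≡⟨ cong (λ w → (reverse (dropOnes r) ++ w) ++ ys) (reverse-replicate (leadOnes r) 1) ⟨
  (reverse (dropOnes r) ++ reverse (replicate (leadOnes r) 1)) ++ ys ≡⟨ cong (_++ ys) (reverse-++ (replicate (leadOnes r) 1) (dropOnes r)) ⟨
  reverse (replicate (leadOnes r) 1 ++ dropOnes r) ++ ys           ≡⟨ cong (λ w → reverse w ++ ys) (leadOnes-dropOnes r) ⟩
  reverse r ++ ys                                                  ∎

unitsFrom : (racc X : List ℕ) → Positive racc → Units (reverse racc ++ X ∷ʳ 0)
unitsFrom racc []          pos = subst Units (reverse-dropOnes-++ racc (0 ∷ []))
  (unit (dropOnes racc) (leadOnes racc) (dropOnes-positive racc pos) (dropOnes-noLeadingOne racc) [])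
unitsFrom racc (zero ∷ X)  pos = subst Units (reverse-dropOnes-++ racc (0 ∷ X ∷ʳ 0))
  (unit (dropOnes racc) (leadOnes racc) (dropOnes-positive racc pos) (dropOnes-noLeadingOne racc) (unitsFrom [] X []))
unitsFrom racc (suc x ∷ X) pos = subst Units (reverse-∷-++ (suc x) racc (X ∷ʳ 0)) (unitsFrom (suc x ∷ racc) X (s≤s z≤n ∷ pos))

-- The move P2 on a single block

decLast-∷ʳ : (M : List ℕ) (y : ℕ) → decLast (M ∷ʳ y) ≡ M ∷ʳ (y ∸ 1)
decLast-∷ʳ []           y = refl
decLast-∷ʳ (m ∷ [])     y = refl
decLast-∷ʳ (m ∷ n ∷ M)  y = cong (m ∷_) (decLast-∷ʳ (n ∷ M) y)

p2-∷ʳ : (x : ℕ) (M : List ℕ) (y : ℕ) → p2 (x ∷ M ∷ʳ y) ≡ suc x ∷ M ∷ʳ (y ∸ 1)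
p2-∷ʳ x []      y = refl
p2-∷ʳ x (m ∷ M) y = cong (suc x ∷_) (decLast-∷ʳ (m ∷ M) y)

length-p2 : (xs : List ℕ) → length (p2 xs) ≡ length xs
length-p2 xs with xs
... | []         = refl
... | _ ∷ []     = refl
... | x ∷ y ∷ zs = cong suc (length-decLast (y ∷ zs))
  where
  length-decLast : (l : List ℕ) → length (decLast l) ≡ length l
  length-decLast []           = refl
  length-decLast (x ∷ [])     = refl
  length-decLast (x ∷ y ∷ zs) = cong suc (length-decLast (y ∷ zs))

sum-p2 : (xs : List ℕ) → Positive xs → sum (p2 xs) ≡ sum xs
sum-p2 []           _          = refl
sum-p2 (x ∷ [])     _          = refl
sum-p2 (x ∷ y ∷ zs) (_ ∷ pos) = trans (sym (+-suc x _)) (cong (x +_) (suc-sum-decLast y zs pos))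
  where
  suc-sum-decLast : (x : ℕ) (l : List ℕ) → Positive (x ∷ l) → suc (sum (decLast (x ∷ l))) ≡ sum (x ∷ l)
  suc-sum-decLast (suc x) []      _         = refl
  suc-sum-decLast x       (y ∷ l) (_ ∷ pos) = trans (sym (+-suc x _)) (cong (x +_) (suc-sum-decLast y l pos))

-- The shape of a block B′ = reverse R: P2 acts on its first and last entries,
-- and a last entry of 1 would have been a trailing one.
data BlockShape : List ℕ → Set where
  empty     : BlockShape []
  singleton : (b : ℕ) → 1 ≤ b → NoLeadingOne (b ∷ []) → BlockShape (b ∷ [])
  long      : (b : ℕ) (M : List ℕ) (y : ℕ) → 1 ≤ b → Positive M → BlockShape (b ∷ M ∷ʳ suc (suc y))

blockShape : (R : List ℕ) → Positive R → NoLeadingOne R → BlockShape (reverse R)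
blockShape []                         _            _ = empty
blockShape (r ∷ [])                   (p ∷ [])     h = singleton r p h
blockShape (zero ∷ r ∷ rs)            (() ∷ _)     _
blockShape (suc zero ∷ r ∷ rs)        _            ()
blockShape (suc (suc y) ∷ r ∷ rs)     (_ ∷ pos)    _ with ∷-∷ʳ-view r rs
... | Q , b , eq = subst BlockShape (sym reversed)
  (long b (reverse Q) y (lastPositive (subst Positive eq pos)) (Positive-reverse (++⁻ˡ Q (subst Positive eq pos))))
  where
  reversed : reverse (suc (suc y) ∷ r ∷ rs) ≡ b ∷ reverse Q ∷ʳ suc (suc y)
  reversed = begin
    reverse (suc (suc y) ∷ r ∷ rs)   ≡⟨ unfold-reverse (suc (suc y)) (r ∷ rs) ⟩
    reverse (r ∷ rs) ∷ʳ suc (suc y)  ≡⟨ cong (λ w → reverse w ∷ʳ suc (suc y)) eq ⟩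
    reverse (Q ∷ʳ b) ∷ʳ suc (suc y)  ≡⟨ cong (_∷ʳ suc (suc y)) (reverse-++ Q (b ∷ [])) ⟩
    b ∷ reverse Q ∷ʳ suc (suc y)     ∎
  lastPositive : Positive (Q ∷ʳ b) → 1 ≤ b
  lastPositive ps with ++⁻ʳ Q ps
  ... | p ∷ [] = p

p2-block : {B : List ℕ} → BlockShape B → Positive (p2 B) × NoLeadingOne (p2 B)
p2-block empty                    = [] , tt
p2-block (singleton b p h)        = p ∷ [] , h
p2-block (long (suc b) M y _ pos) rewrite p2-∷ʳ (suc b) M (suc (suc y)) = s≤s z≤n ∷ ++⁺ pos (s≤s z≤n ∷ []) , tt

p2-reverse-p2 : {B : List ℕ} → BlockShape B → p2 (reverse (p2 B)) ≡ reverse B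
p2-reverse-p2 empty             = refl
p2-reverse-p2 (singleton b p h) = refl
p2-reverse-p2 (long b M y p pos) = begin
  p2 (reverse (p2 (b ∷ M ∷ʳ suc (suc y))))         ≡⟨ cong (p2 ∘ reverse) (p2-∷ʳ b M (suc (suc y))) ⟩
  p2 (reverse (suc b ∷ M ∷ʳ suc y))                ≡⟨ cong p2 (reverse-∷-∷ʳ (suc b) M (suc y)) ⟩
  p2 (suc y ∷ reverse M ∷ʳ suc b)                  ≡⟨ p2-∷ʳ (suc y) (reverse M) (suc b) ⟩
  suc (suc y) ∷ reverse M ∷ʳ b                     ≡⟨ reverse-∷-∷ʳ b M (suc (suc y)) ⟨
  reverse (b ∷ M ∷ʳ suc (suc y))                   ∎
  where
  reverse-∷-∷ʳ : (x : ℕ) (M : List ℕ) (y : ℕ) → reverse (x ∷ M ∷ʳ y) ≡ y ∷ reverse M ∷ʳ x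
  reverse-∷-∷ʳ x M y = begin
    reverse (x ∷ M ∷ʳ y)   ≡⟨ unfold-reverse x (M ∷ʳ y) ⟩
    reverse (M ∷ʳ y) ∷ʳ x  ≡⟨ cong (_∷ʳ x) (reverse-++ M (y ∷ [])) ⟩
    y ∷ reverse M ∷ʳ x     ∎

p2-reverse-involutive : (R : List ℕ) → Positive R → NoLeadingOne R →
                        Positive (p2 (reverse R)) × NoLeadingOne (p2 (reverse R)) × p2 (reverse (p2 (reverse R))) ≡ R
p2-reverse-involutive R pos h with p2-block (blockShape R pos h)
... | pos′ , h′ = pos′ , h′ , trans (p2-reverse-p2 (blockShape R pos h)) (reverse-involutive R)

-- linProc unit by unit

length-linProc : {D : List ℕ} → Units D → length (linProc [] D) ≡ length D
length-linProc []                      = refl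
length-linProc (unit R t {D} pos h u) = begin
  length (linProc [] (reverse R ++ replicate t 1 ++ 0 ∷ D))
    ≡⟨ cong length (linProc-unit R t D pos h) ⟩
  length ((p2 (reverse R) ++ 0 ∷ replicate t 1) ++ linProc [] D)
    ≡⟨ length-++ (p2 (reverse R) ++ _) ⟩
  length (p2 (reverse R) ++ 0 ∷ replicate t 1) + length (linProc [] D)
    ≡⟨ cong₂ _+_ (length-++ (p2 (reverse R))) (length-linProc u) ⟩
  (length (p2 (reverse R)) + suc (length (replicate t 1))) + length D
    ≡⟨ cong (λ n → (n + suc (length (replicate t 1))) + length D) (length-p2 (reverse R)) ⟩
  (length (reverse R) + suc (length (replicate t 1))) + length D
    ≡⟨ +-assoc (length (reverse R)) _ (length D) ⟩
  length (reverse R) + (suc (length (replicate t 1)) + length D)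
    ≡⟨ cong (length (reverse R) +_) (+-suc (length (replicate t 1)) (length D)) ⟨
  length (reverse R) + (length (replicate t 1) + length (0 ∷ D))
    ≡⟨ cong (length (reverse R) +_) (length-++ (replicate t 1)) ⟨
  length (reverse R) + length (replicate t 1 ++ 0 ∷ D)
    ≡⟨ length-++ (reverse R) ⟨
  length (reverse R ++ replicate t 1 ++ 0 ∷ D)
    ∎

sum-linProc : {D : List ℕ} → Units D → sum (linProc [] D) ≡ sum D
sum-linProc []                      = refl
sum-linProc (unit R t {D} pos h u) = begin
  sum (linProc [] (reverse R ++ replicate t 1 ++ 0 ∷ D))
    ≡⟨ cong sum (linProc-unit R t D pos h) ⟩
  sum ((p2 (reverse R) ++ 0 ∷ replicate t 1) ++ linProc [] D)
    ≡⟨ sum-++ (p2 (reverse R) ++ _) _ ⟩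
  sum (p2 (reverse R) ++ 0 ∷ replicate t 1) + sum (linProc [] D)
    ≡⟨ cong₂ _+_ (sum-++ (p2 (reverse R)) _) (sum-linProc u) ⟩
  (sum (p2 (reverse R)) + sum (replicate t 1)) + sum D
    ≡⟨ cong (λ n → (n + sum (replicate t 1)) + sum D) (sum-p2 (reverse R) (Positive-reverse pos)) ⟩
  (sum (reverse R) + sum (replicate t 1)) + sum D
    ≡⟨ +-assoc (sum (reverse R)) _ (sum D) ⟩
  sum (reverse R) + (sum (replicate t 1) + sum (0 ∷ D))
    ≡⟨ cong (sum (reverse R) +_) (sum-++ (replicate t 1) (0 ∷ D)) ⟨
  sum (reverse R) + sum (replicate t 1 ++ 0 ∷ D)
    ≡⟨ sum-++ (reverse R) _ ⟨
  sum (reverse R ++ replicate t 1 ++ 0 ∷ D)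
    ∎

lastOnes : ℕ → {D : List ℕ} → Units D → ℕ
lastOnes s []               = s
lastOnes s (unit _ t _ _ u) = lastOnes t u

-- Reversed, the output unit P2(B′) 0 1ᵗ reads 1ᵗ 0 reverse(P2(B′)); pairing each reversed
-- block with the ones of the preceding unit (s for the first one) gives the units of
-- mirror, a rotation of reverse (linProc [] D) that ends in a zero; mirrorImage is the
-- matching rotation of reverse D.
mirror : ℕ → {D : List ℕ} → Units D → List ℕ
mirror s []               = []
mirror s (unit R t _ _ u) = mirror t u ++ reverse (p2 (reverse R)) ++ replicate s 1 ++ 0 ∷ []

mirrorImage : ℕ → {D : List ℕ} → Units D → List ℕ
mirrorImage s []               = []
mirrorImage s (unit R t _ _ u) = mirrorImage t u ++ R ++ 0 ∷ replicate s 1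

++-reassoc : (X Y Z W : List A) → (X ++ Y ++ Z) ++ W ≡ (X ++ Y) ++ Z ++ W
++-reassoc X Y Z W = begin
  (X ++ Y ++ Z) ++ W   ≡⟨ ++-assoc X (Y ++ Z) W ⟩
  X ++ (Y ++ Z) ++ W   ≡⟨ cong (X ++_) (++-assoc Y Z W) ⟩
  X ++ Y ++ Z ++ W     ≡⟨ ++-assoc X Y (Z ++ W) ⟨
  (X ++ Y) ++ Z ++ W   ∎

reverse-linProc-rotation : (s : ℕ) {D : List ℕ} (u : Units D) →
  reverse (linProc [] D) ++ replicate s 1 ++ 0 ∷ [] ≡ (replicate (lastOnes s u) 1 ++ 0 ∷ []) ++ mirror s u
reverse-linProc-rotation s []                      = sym (++-identityʳ _)
reverse-linProc-rotation s (unit R t {D} pos h u) = begin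
  reverse (linProc [] (reverse R ++ replicate t 1 ++ 0 ∷ D)) ++ W
    ≡⟨ cong (λ z → reverse z ++ W) (linProc-unit R t D pos h) ⟩
  reverse ((P ++ 0 ∷ replicate t 1) ++ linProc [] D) ++ W
    ≡⟨ cong (_++ W) (reverse-++ (P ++ 0 ∷ replicate t 1) (linProc [] D)) ⟩
  (reverse (linProc [] D) ++ reverse (P ++ 0 ∷ replicate t 1)) ++ W
    ≡⟨ cong (λ z → (reverse (linProc [] D) ++ z) ++ W) reverse-unitImage ⟩
  (reverse (linProc [] D) ++ (replicate t 1 ++ 0 ∷ []) ++ reverse P) ++ W
    ≡⟨ ++-reassoc (reverse (linProc [] D)) _ (reverse P) W ⟩
  (reverse (linProc [] D) ++ replicate t 1 ++ 0 ∷ []) ++ reverse P ++ W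
    ≡⟨ cong (_++ reverse P ++ W) (reverse-linProc-rotation t u) ⟩
  ((replicate (lastOnes t u) 1 ++ 0 ∷ []) ++ mirror t u) ++ reverse P ++ W
    ≡⟨ ++-assoc (replicate (lastOnes t u) 1 ++ 0 ∷ []) (mirror t u) _ ⟩
  (replicate (lastOnes t u) 1 ++ 0 ∷ []) ++ mirror t u ++ reverse P ++ W
    ∎
  where
  W : List ℕ
  W = replicate s 1 ++ 0 ∷ []
  P : List ℕ
  P = p2 (reverse R)
  reverse-unitImage : reverse (P ++ 0 ∷ replicate t 1) ≡ (replicate t 1 ++ 0 ∷ []) ++ reverse P
  reverse-unitImage = begin
    reverse (P ++ 0 ∷ replicate t 1)               ≡⟨ reverse-++ P (0 ∷ replicate t 1) ⟩
    reverse (0 ∷ replicate t 1) ++ reverse P        ≡⟨ cong (_++ reverse P) (unfold-reverse 0 (replicate t 1)) ⟩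
    (reverse (replicate t 1) ∷ʳ 0) ++ reverse P     ≡⟨ cong (λ w → (w ∷ʳ 0) ++ reverse P) (reverse-replicate t 1) ⟩
    (replicate t 1 ++ 0 ∷ []) ++ reverse P          ∎

reverse-rotation : (s : ℕ) {D : List ℕ} (u : Units D) →
  reverse D ++ 0 ∷ replicate s 1 ≡ (0 ∷ replicate (lastOnes s u) 1) ++ mirrorImage s u
reverse-rotation s []                      = sym (++-identityʳ _)
reverse-rotation s (unit R t {D} pos h u) = begin
  reverse (reverse R ++ replicate t 1 ++ 0 ∷ D) ++ W
    ≡⟨ cong (_++ W) reverse-unit ⟩
  ((reverse D ++ 0 ∷ replicate t 1) ++ R) ++ W
    ≡⟨ ++-assoc (reverse D ++ 0 ∷ replicate t 1) R W ⟩
  (reverse D ++ 0 ∷ replicate t 1) ++ R ++ W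
    ≡⟨ cong (_++ R ++ W) (reverse-rotation t u) ⟩
  ((0 ∷ replicate (lastOnes t u) 1) ++ mirrorImage t u) ++ R ++ W
    ≡⟨ ++-assoc (0 ∷ replicate (lastOnes t u) 1) (mirrorImage t u) _ ⟩
  (0 ∷ replicate (lastOnes t u) 1) ++ mirrorImage t u ++ R ++ W
    ∎
  where
  W : List ℕ
  W = 0 ∷ replicate s 1
  reverse-unit : reverse (reverse R ++ replicate t 1 ++ 0 ∷ D) ≡ (reverse D ++ 0 ∷ replicate t 1) ++ R
  reverse-unit = begin
    reverse (reverse R ++ replicate t 1 ++ 0 ∷ D)             ≡⟨ reverse-++ (reverse R) _ ⟩
    reverse (replicate t 1 ++ 0 ∷ D) ++ reverse (reverse R)   ≡⟨ cong₂ _++_ (reverse-++ (replicate t 1) (0 ∷ D)) (reverse-involutive R) ⟩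
    (reverse (0 ∷ D) ++ reverse (replicate t 1)) ++ R         ≡⟨ cong₂ (λ a b → (a ++ b) ++ R) (unfold-reverse 0 D) (reverse-replicate t 1) ⟩
    ((reverse D ∷ʳ 0) ++ replicate t 1) ++ R                  ≡⟨ cong (_++ R) (++-assoc (reverse D) (0 ∷ []) (replicate t 1)) ⟩
    (reverse D ++ 0 ∷ replicate t 1) ++ R                     ∎

linProc-mirror-++ : (s : ℕ) {D : List ℕ} (u : Units D) (Y : List ℕ) →
                    linProc [] (mirror s u ++ Y) ≡ mirrorImage s u ++ linProc [] Y
linProc-mirror-++ s []                      Y = refl
linProc-mirror-++ s (unit R t {D} pos h u) Y with p2-reverse-involutive R pos h
... | pos′ , h′ , involutive = begin
  linProc [] ((mirror t u ++ reverse P ++ W) ++ Y)     ≡⟨ cong (linProc []) (++-assoc (mirror t u) _ Y) ⟩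
  linProc [] (mirror t u ++ (reverse P ++ W) ++ Y)     ≡⟨ linProc-mirror-++ t u _ ⟩
  mirrorImage t u ++ linProc [] ((reverse P ++ W) ++ Y) ≡⟨ cong (λ z → mirrorImage t u ++ linProc [] z) (trans (++-assoc (reverse P) W Y) (cong (reverse P ++_) (++-assoc (replicate s 1) (0 ∷ []) Y))) ⟩
  mirrorImage t u ++ linProc [] (reverse P ++ replicate s 1 ++ 0 ∷ Y)
    ≡⟨ cong (mirrorImage t u ++_) (linProc-unit P s Y pos′ h′) ⟩
  mirrorImage t u ++ (p2 (reverse P) ++ 0 ∷ replicate s 1) ++ linProc [] Y
    ≡⟨ cong (λ z → mirrorImage t u ++ (z ++ 0 ∷ replicate s 1) ++ linProc [] Y) involutive ⟩
  mirrorImage t u ++ (R ++ 0 ∷ replicate s 1) ++ linProc [] Y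
    ≡⟨ ++-assoc (mirrorImage t u) _ _ ⟨
  (mirrorImage t u ++ R ++ 0 ∷ replicate s 1) ++ linProc [] Y ∎
  where
  P : List ℕ
  P = p2 (reverse R)
  W : List ℕ
  W = replicate s 1 ++ 0 ∷ []

-- phiSeq as a rotation of linProc

firstZero-positive : (d : List ℕ) → Positive d → firstZero d ≡ nothing
firstZero-positive []          _         = refl
firstZero-positive (suc x ∷ d) (_ ∷ pos) rewrite firstZero-positive d pos = refl

firstZero-++ : (A P : List ℕ) → Positive A → firstZero (A ++ 0 ∷ P) ≡ just (length A)
firstZero-++ []          P _         = refl
firstZero-++ (suc x ∷ A) P (_ ∷ pos) rewrite firstZero-++ A P pos = refl

zeroView : (d : List ℕ) → Positive d ⊎ ∃₂ λ A P → Positive A × d ≡ A ++ 0 ∷ P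
zeroView []          = inj₁ []
zeroView (zero ∷ d)  = inj₂ ([] , d , [] , refl)
zeroView (suc x ∷ d) with zeroView d
... | inj₁ pos                = inj₁ (s≤s z≤n ∷ pos)
... | inj₂ (A , P , pos , eq) = inj₂ (suc x ∷ A , P , s≤s z≤n ∷ pos , cong (suc x ∷_) eq)

phiSeq-positive : (d : List ℕ) → Positive d → phiSeq d ≡ d
phiSeq-positive d pos rewrite firstZero-positive d pos = refl

unitsOf : (X : List ℕ) → Units (X ∷ʳ 0)
unitsOf X = unitsFrom [] X []

rotate-zero : (A P : List ℕ) → rotate (length P) (P ++ A ++ 0 ∷ []) ≡ A ++ 0 ∷ P
rotate-zero A P = trans (rotate-++ P (A ∷ʳ 0)) (++-assoc A (0 ∷ []) P)

phiSeq-canonical : (A P : List ℕ) → Positive A → phiSeq (A ++ 0 ∷ P) ≡ rotate (length P) (linProc [] (P ++ A ++ 0 ∷ []))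
phiSeq-canonical A P pos rewrite firstZero-++ A P pos = begin
  rotL (length (A ++ 0 ∷ P) ∸ suc (length A)) (linProc [] (rotL (suc (length A)) (A ++ 0 ∷ P)))
    ≡⟨ cong₂ (λ n xs → rotL n (linProc [] xs)) remaining moved ⟩
  rotL (length P) L
    ≡⟨ rotL≡rotate (length P) L (subst (length P ≤_) (sym length-L) (m≤m+n (length P) _)) ⟩
  rotate (length P) L ∎
  where
  L : List ℕ
  L = linProc [] (P ++ A ++ 0 ∷ [])
  length-A0P : length (A ++ 0 ∷ P) ≡ suc (length A) + length P
  length-A0P = trans (length-++ A) (+-suc (length A) (length P))
  remaining : length (A ++ 0 ∷ P) ∸ suc (length A) ≡ length P
  remaining = trans (cong (_∸ suc (length A)) length-A0P) (m+n∸m≡n (suc (length A)) (length P))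
  moved : rotL (suc (length A)) (A ++ 0 ∷ P) ≡ P ++ A ++ 0 ∷ []
  moved = begin
    rotL (suc (length A)) (A ++ 0 ∷ P)
      ≡⟨ rotL≡rotate (suc (length A)) (A ++ 0 ∷ P) (subst (suc (length A) ≤_) (sym length-A0P) (m≤m+n _ _)) ⟩
    rotate (suc (length A)) (A ++ 0 ∷ P)
      ≡⟨ cong₂ rotate (length-∷ʳ A 0) (++-assoc A (0 ∷ []) P) ⟨
    rotate (length (A ∷ʳ 0)) ((A ∷ʳ 0) ++ P)
      ≡⟨ rotate-++ (A ∷ʳ 0) P ⟩
    P ++ A ++ 0 ∷ [] ∎
  length-L : length L ≡ length P + length (A ∷ʳ 0)
  length-L = trans (length-linProc (subst Units (++-assoc P A (0 ∷ [])) (unitsOf (P ++ A)))) (length-++ P)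

phiSeq-∷ʳ0 : (X : List ℕ) → phiSeq (X ∷ʳ 0) ≡ linProc [] (X ∷ʳ 0)
phiSeq-∷ʳ0 X with zeroView X
... | inj₁ pos = phiSeq-canonical X [] pos
... | inj₂ (A , P , pos , refl) = begin
  phiSeq ((A ++ 0 ∷ P) ∷ʳ 0)
    ≡⟨ cong phiSeq (++-assoc A (0 ∷ P) (0 ∷ [])) ⟩
  phiSeq (A ++ 0 ∷ P ∷ʳ 0)
    ≡⟨ phiSeq-canonical A (P ∷ʳ 0) pos ⟩
  rotate (length (P ∷ʳ 0)) (linProc [] ((P ∷ʳ 0) ++ A0))
    ≡⟨ cong₂ rotate (sym (length-linProc (unitsOf P))) (linProc-++ [] P A0) ⟩
  rotate (length (linProc [] (P ∷ʳ 0))) (linProc [] (P ∷ʳ 0) ++ linProc [] A0)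
    ≡⟨ rotate-++ (linProc [] (P ∷ʳ 0)) _ ⟩
  linProc [] A0 ++ linProc [] (P ∷ʳ 0)
    ≡⟨ linProc-++ [] A (P ∷ʳ 0) ⟨
  linProc [] (A0 ++ P ∷ʳ 0)
    ≡⟨ cong (linProc []) (trans (++-assoc A (0 ∷ []) (P ∷ʳ 0)) (sym (++-assoc A (0 ∷ P) (0 ∷ [])))) ⟩
  linProc [] ((A ++ 0 ∷ P) ∷ʳ 0)
    ∎
  where
  A0 : List ℕ
  A0 = A ∷ʳ 0

rotate₁-rotate : (k : ℕ) (xs : List A) → rotate₁ (rotate k xs) ≡ rotate (suc k) xs
rotate₁-rotate k xs = trans (sym (rotate-+ k 1 xs)) (cong (λ m → rotate m xs) (+-comm k 1))

phiSeq-rotate₁ : (d : List ℕ) → phiSeq (rotate₁ d) ≡ rotate₁ (phiSeq d)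
phiSeq-rotate₁ d with zeroView d
... | inj₁ pos = trans (phiSeq-positive (rotate₁ d) (All-resp-↭ (↭-sym (rotate-↭ 1 d)) pos)) (cong rotate₁ (sym (phiSeq-positive d pos)))
... | inj₂ ([] , P , _ , refl) = begin
  phiSeq (P ∷ʳ 0)                 ≡⟨ phiSeq-∷ʳ0 P ⟩
  L                               ≡⟨ rotate-length L ⟨
  rotate (length L) L             ≡⟨ cong (λ m → rotate m L) (trans (length-linProc (unitsOf P)) (length-∷ʳ P 0)) ⟩
  rotate (suc (length P)) L       ≡⟨ rotate₁-rotate (length P) L ⟨
  rotate₁ (rotate (length P) L)   ≡⟨ cong rotate₁ (phiSeq-canonical [] P []) ⟨
  rotate₁ (phiSeq (0 ∷ P))        ∎
  where
  L : List ℕ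
  L = linProc [] (P ∷ʳ 0)
... | inj₂ (a ∷ A , P , p ∷ pos , refl) = begin
  phiSeq ((A ++ 0 ∷ P) ∷ʳ a)                                 ≡⟨ cong phiSeq (++-assoc A (0 ∷ P) (a ∷ [])) ⟩
  phiSeq (A ++ 0 ∷ P ∷ʳ a)                                   ≡⟨ phiSeq-canonical A (P ∷ʳ a) pos ⟩
  rotate (length (P ∷ʳ a)) (linProc [] ((P ∷ʳ a) ++ A ++ 0 ∷ []))
    ≡⟨ cong₂ (λ m xs → rotate m (linProc [] xs)) (length-∷ʳ P a) (++-assoc P (a ∷ []) _) ⟩
  rotate (suc (length P)) L                                  ≡⟨ rotate₁-rotate (length P) L ⟨
  rotate₁ (rotate (length P) L)                              ≡⟨ cong rotate₁ (phiSeq-canonical (a ∷ A) P (p ∷ pos)) ⟨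
  rotate₁ (phiSeq (a ∷ A ++ 0 ∷ P))                          ∎
  where
  L : List ℕ
  L = linProc [] (P ++ a ∷ A ++ 0 ∷ [])

phiSeq-rotate : (k : ℕ) (d : List ℕ) → phiSeq (rotate k d) ≡ rotate k (phiSeq d)
phiSeq-rotate zero    d = refl
phiSeq-rotate (suc k) d = trans (phiSeq-rotate k (rotate₁ d)) (cong (rotate k) (phiSeq-rotate₁ d))

data PhiView (d : List ℕ) : Set where
  positive : Positive d → phiSeq d ≡ d → PhiView d
  rotated  : (k : ℕ) (X : List ℕ) → d ≡ rotate k (X ∷ʳ 0) → phiSeq d ≡ rotate k (linProc [] (X ∷ʳ 0)) → PhiView d

phiView : (d : List ℕ) → PhiView d
phiView d with zeroView d
... | inj₁ pos                   = positive pos (phiSeq-positive d pos)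
... | inj₂ (A , P , pos , refl) = rotated (length P) (P ++ A)
  (sym (trans (cong (rotate (length P)) (++-assoc P A (0 ∷ []))) (rotate-zero A P)))
  (trans (phiSeq-canonical A P pos) (cong (rotate (length P) ∘ linProc []) (sym (++-assoc P A (0 ∷ [])))))

length-phiSeq : (d : List ℕ) → length (phiSeq d) ≡ length d
length-phiSeq d with phiView d
... | positive _ φd≡d         = cong length φd≡d
... | rotated k X refl φd≡ = begin
  length (phiSeq (rotate k D))         ≡⟨ cong length φd≡ ⟩
  length (rotate k (linProc [] D))     ≡⟨ length-rotate k _ ⟩
  length (linProc [] D)                ≡⟨ length-linProc (unitsOf X) ⟩
  length D                             ≡⟨ length-rotate k D ⟨
  length (rotate k D)                  ∎
  where
  D : List ℕ
  D = X ∷ʳ 0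

sum-phiSeq : (d : List ℕ) → sum (phiSeq d) ≡ sum d
sum-phiSeq d with phiView d
... | positive _ φd≡d         = cong sum φd≡d
... | rotated k X refl φd≡ = begin
  sum (phiSeq (rotate k D))         ≡⟨ cong sum φd≡ ⟩
  sum (rotate k (linProc [] D))     ≡⟨ sum-↭ (rotate-↭ k _) ⟩
  sum (linProc [] D)                ≡⟨ sum-linProc (unitsOf X) ⟩
  sum D                             ≡⟨ sum-↭ (rotate-↭ k D) ⟨
  sum (rotate k D)                  ∎
  where
  D : List ℕ
  D = X ∷ʳ 0

phiSeq-mirror : (s : ℕ) {D : List ℕ} (u : Units D) → phiSeq (mirror s u) ≡ mirrorImage s u
phiSeq-mirror s []                  = refl
phiSeq-mirror s u@(unit R t _ _ u′) = begin
  phiSeq (mirror s u)            ≡⟨ cong phiSeq ends-in-zero ⟩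
  phiSeq (M ∷ʳ 0)                ≡⟨ phiSeq-∷ʳ0 M ⟩
  linProc [] (M ∷ʳ 0)            ≡⟨ cong (linProc []) (trans (sym ends-in-zero) (sym (++-identityʳ _))) ⟩
  linProc [] (mirror s u ++ [])  ≡⟨ linProc-mirror-++ s u [] ⟩
  mirrorImage s u ++ []          ≡⟨ ++-identityʳ _ ⟩
  mirrorImage s u                ∎
  where
  P M : List ℕ
  P = reverse (p2 (reverse R))
  M = mirror t u′ ++ P ++ replicate s 1
  ends-in-zero : mirror s u ≡ M ∷ʳ 0
  ends-in-zero = sym (trans (++-assoc (mirror t u′) (P ++ replicate s 1) (0 ∷ []))
                            (cong (mirror t u′ ++_) (++-assoc P (replicate s 1) (0 ∷ []))))

phiSeq-reverse-linProc : {D : List ℕ} → Units D → phiSeq (reverse (linProc [] D)) ≡ reverse D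
phiSeq-reverse-linProc []                     = refl
phiSeq-reverse-linProc {D} u@(unit _ _ _ _ _) = begin
  phiSeq X                                  ≡⟨ cong phiSeq (rotate-inverse (suc s) X) ⟨
  phiSeq (rotate m (rotate (suc s) X))      ≡⟨ cong (phiSeq ∘ rotate m) X-rotated ⟩
  phiSeq (rotate m (mirror s u))            ≡⟨ phiSeq-rotate m (mirror s u) ⟩
  rotate m (phiSeq (mirror s u))            ≡⟨ cong (rotate m) (phiSeq-mirror s u) ⟩
  rotate m (mirrorImage s u)                ≡⟨ cong (rotate m) D-rotated ⟨
  rotate m (rotate (suc s) (reverse D))     ≡⟨ cong (λ n → rotate (suc s * (n ∸ 1)) (rotate (suc s) (reverse D))) length-X ⟩
  rotate (suc s * (length (reverse D) ∸ 1)) (rotate (suc s) (reverse D)) ≡⟨ rotate-inverse (suc s) (reverse D) ⟩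
  reverse D                                 ∎
  where
  -- For u nonempty lastOnes s u does not depend on s, so this choice of s makes both
  -- rotation lemmas conjugations by the same word.
  s : ℕ
  s = lastOnes 0 u
  X : List ℕ
  X = reverse (linProc [] D)
  m : ℕ
  m = suc s * (length X ∸ 1)
  length-ones0 : length (replicate s 1 ∷ʳ 0) ≡ suc s
  length-ones0 = trans (length-∷ʳ (replicate s 1) 0) (cong suc (length-replicate s))
  X-rotated : rotate (suc s) X ≡ mirror s u
  X-rotated = trans (cong (λ k → rotate k X) (sym length-ones0)) (rotate-conjugate X _ _ (reverse-linProc-rotation s u))
  D-rotated : rotate (suc s) (reverse D) ≡ mirrorImage s u
  D-rotated = trans (cong (λ k → rotate (suc k) (reverse D)) (sym (length-replicate s)))
                    (rotate-conjugate (reverse D) (0 ∷ replicate s 1) _ (reverse-rotation s u))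
  length-X : length X ≡ length (reverse D)
  length-X = trans (length-reverse (linProc [] D)) (trans (length-linProc u) (sym (length-reverse D)))

phiSeq-reverse-phiSeq : (d : List ℕ) → phiSeq (reverse (phiSeq d)) ≡ reverse d
phiSeq-reverse-phiSeq d with phiView d
... | positive pos φd≡d = trans (cong (phiSeq ∘ reverse) φd≡d) (phiSeq-positive (reverse d) (Positive-reverse pos))
... | rotated k X refl φd≡ = begin
  phiSeq (reverse (phiSeq (rotate k D)))       ≡⟨ cong (phiSeq ∘ reverse) φd≡ ⟩
  phiSeq (reverse (rotate k L))                ≡⟨ cong phiSeq (reverse-rotate k L) ⟩
  phiSeq (rotate (k * (length L ∸ 1)) (reverse L)) ≡⟨ phiSeq-rotate (k * (length L ∸ 1)) (reverse L) ⟩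
  rotate (k * (length L ∸ 1)) (phiSeq (reverse L)) ≡⟨ cong₂ (λ n xs → rotate (k * (n ∸ 1)) xs) (length-linProc u) (phiSeq-reverse-linProc u) ⟩
  rotate (k * (length D ∸ 1)) (reverse D)      ≡⟨ reverse-rotate k D ⟨
  reverse (rotate k D)                         ∎
  where
  D : List ℕ
  D = X ∷ʳ 0
  u : Units (X ∷ʳ 0)
  u = unitsOf X
  L : List ℕ
  L = linProc [] D

phiSeq-injective : (d d′ : List ℕ) → phiSeq d ≡ phiSeq d′ → d ≡ d′
phiSeq-injective d d′ eq = reverse-injective (begin
  reverse d                        ≡⟨ phiSeq-reverse-phiSeq d ⟨
  phiSeq (reverse (phiSeq d))      ≡⟨ cong (phiSeq ∘ reverse) eq ⟩
  phiSeq (reverse (phiSeq d′))     ≡⟨ phiSeq-reverse-phiSeq d′ ⟩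
  reverse d′                       ∎)

phiSeq-reverse-phiSeq-reverse : (e : List ℕ) → phiSeq (reverse (phiSeq (reverse e))) ≡ e
phiSeq-reverse-phiSeq-reverse e = trans (phiSeq-reverse-phiSeq (reverse e)) (reverse-involutive e)

-- Sequences of lower and upper ideals

-- An entry (v , c) describes v elements taken from a chain with c + 1 elements.
Fits : ℕ × ℕ → Set
Fits (v , c) = v ≤ suc c

NotFull : ℕ × ℕ → Set
NotFull (v , c) = v ≤ c

-- From the cover relation min D_(i-1) ⋖ max D_i.
LowerLink : ℕ × ℕ → ℕ × ℕ → Set
LowerLink (v , _) q = v ≡ 0 → NotFull q

UpperLink : ℕ × ℕ → ℕ × ℕ → Set
UpperLink p (w , _) = w ≡ 0 → NotFull p

CyclicFit : (ℕ × ℕ → ℕ × ℕ → Set) → List (ℕ × ℕ) → Set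
CyclicFit R Z = Cyclic R Z × All Fits Z

LowerSeq : List ℕ → List ℕ → Set
LowerSeq cs d = CyclicFit LowerLink (zip d cs)

UpperSeq : List ℕ → List ℕ → Set
UpperSeq cs e = CyclicFit UpperLink (zip e cs)

CyclicFit-rotate : {R : ℕ × ℕ → ℕ × ℕ → Set} (k : ℕ) (Z : List (ℕ × ℕ)) → CyclicFit R Z → CyclicFit R (rotate k Z)
CyclicFit-rotate k Z (c , fits) = Cyclic-rotate k Z c , All-resp-↭ (↭-sym (rotate-↭ k Z)) fits

CyclicFit-reverse : {R : ℕ × ℕ → ℕ × ℕ → Set} (Z : List (ℕ × ℕ)) → CyclicFit R Z → CyclicFit (flip R) (reverse Z)
CyclicFit-reverse Z (c , fits) = Cyclic-reverse Z c , All-resp-↭ (↭-sym (↭-reverse Z)) fits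

-- flip UpperLink is LowerLink by definition, so reversal turns upper sequences into lower ones.
UpperSeq-reverse : (cs e : List ℕ) → length e ≡ length cs → UpperSeq cs e → LowerSeq (reverse cs) (reverse e)
UpperSeq-reverse cs e eq up = subst (CyclicFit LowerLink) (sym (zip-reverse e cs eq)) (CyclicFit-reverse (zip e cs) up)

-- With every value positive, no link into a zero is ever required.
Linked-upper-positive : (x : ℕ × ℕ) (Z : List (ℕ × ℕ)) → All ((1 ≤_) ∘ proj₁) Z → Linked UpperLink (x ∷ Z)
Linked-upper-positive x []      _        = [-]
Linked-upper-positive x (z ∷ Z) (p ∷ ps) = (λ z≡0 → ⊥-elim (n>0⇒n≢0 p z≡0)) ∷ Linked-upper-positive z Z ps

Cyclic-upper-positive : (Z : List (ℕ × ℕ)) → All ((1 ≤_) ∘ proj₁) Z → Cyclic UpperLink Z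
Cyclic-upper-positive []      _        = tt
Cyclic-upper-positive (z ∷ Z) (p ∷ ps) = Linked-upper-positive z (Z ∷ʳ z) (++⁺ ps (p ∷ []))

-- These segments concatenate (UpperClosed-++), so the filter condition can be checked unit by unit.
UpperClosed : List (ℕ × ℕ) → Set
UpperClosed Z = ∀ x → NotFull x → Linked UpperLink (x ∷ Z) × NotFull (lastOr x Z)

UpperClosed-[] : UpperClosed []
UpperClosed-[] x nf = [-] , nf

UpperClosed-++ : (Z₁ Z₂ : List (ℕ × ℕ)) → UpperClosed Z₁ → UpperClosed Z₂ → UpperClosed (Z₁ ++ Z₂)
UpperClosed-++ Z₁ Z₂ c₁ c₂ x nf with c₁ x nf
... | l₁ , nf₁ with c₂ (lastOr x Z₁) nf₁
... | l₂ , nf₂ = Linked-++ x Z₁ Z₂ l₁ l₂ , subst NotFull (sym (lastOr-++ x Z₁ Z₂)) nf₂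

UpperClosed⇒Cyclic : (Z : List (ℕ × ℕ)) → UpperClosed Z → Cyclic UpperLink Z
UpperClosed⇒Cyclic []      _      = tt
UpperClosed⇒Cyclic (z ∷ Z) closed with closed (0 , 0) z≤n
... | _ , nf with closed (lastOr z Z) nf
... | _ ∷ l , _ = Linked-++ z Z (z ∷ []) l ((λ _ → nf) ∷ [-])

UpperClosed-∷ʳ : (Z : List (ℕ × ℕ)) (z : ℕ × ℕ) → All ((1 ≤_) ∘ proj₁) (Z ∷ʳ z) → NotFull z → UpperClosed (Z ∷ʳ z)
UpperClosed-∷ʳ Z z pos nf x _ = Linked-upper-positive x (Z ∷ʳ z) pos , subst NotFull (sym (lastOr-++ x Z (z ∷ []))) nf

UpperClosed-zeroOnes : (t : ℕ) (cs : List ℕ) → Positive cs → UpperClosed (zip (0 ∷ replicate t 1) cs)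
UpperClosed-zeroOnes t []       _         = UpperClosed-[]
UpperClosed-zeroOnes t (c ∷ cs) (_ ∷ pos) = UpperClosed-++ ((0 , c) ∷ []) (zip (replicate t 1) cs) closedZero (ones t cs pos)
  where
  closedZero : UpperClosed ((0 , c) ∷ [])
  closedZero x nf = (λ _ → nf) ∷ [-] , z≤n
  ones : (t : ℕ) (cs : List ℕ) → Positive cs → UpperClosed (zip (replicate t 1) cs)
  ones zero    cs       _        = UpperClosed-[]
  ones (suc t) []       _        = UpperClosed-[]
  ones (suc t) (c ∷ cs) (p ∷ ps) x nf with ones t cs ps (1 , c) p
  ... | l , nf′ = (λ ()) ∷ l , nf′

Fits-zeroOnes : (t : ℕ) (cs : List ℕ) → All Fits (zip (0 ∷ replicate t 1) cs)
Fits-zeroOnes t []       = []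
Fits-zeroOnes t (c ∷ cs) = z≤n ∷ ones t cs
  where
  ones : (t : ℕ) (cs : List ℕ) → All Fits (zip (replicate t 1) cs)
  ones zero    cs       = []
  ones (suc t) []       = []
  ones (suc t) (c ∷ cs) = s≤s z≤n ∷ ones t cs

HeadNotFull : List (ℕ × ℕ) → Set
HeadNotFull []      = ⊤
HeadNotFull (p ∷ _) = NotFull p

p2-upperClosed : {B : List ℕ} → BlockShape B → (cs : List ℕ) → length cs ≡ length B →
                 HeadNotFull (zip B cs) → All Fits (zip B cs) → UpperClosed (zip (p2 B) cs) × All Fits (zip (p2 B) cs)
p2-upperClosed empty             []       _  _  _    = UpperClosed-[] , []
p2-upperClosed (singleton b p _) (c ∷ []) _  nf fits = UpperClosed-∷ʳ [] (b , c) (p ∷ []) nf , fits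
p2-upperClosed (long b M y p pos) (c ∷ cs) eq nf (_ ∷ fits)
  with ∷ʳ-split cs (length M) (trans (suc-injective eq) (length-∷ʳ M _))
... | cM , cl , refl , lenM = subst (λ Z → UpperClosed Z × All Fits Z) (sym image) (closed , fitsImage)
  where
  z-middle : (v : ℕ) → zip (M ∷ʳ v) (cM ∷ʳ cl) ≡ zip M cM ∷ʳ (v , cl)
  z-middle v = zip-++ M (v ∷ []) cM (cl ∷ []) (sym lenM)
  image : zip (p2 (b ∷ M ∷ʳ suc (suc y))) (c ∷ cM ∷ʳ cl) ≡ (suc b , c) ∷ zip M cM ∷ʳ (suc y , cl)
  image = trans (cong (λ xs → zip xs (c ∷ cM ∷ʳ cl)) (p2-∷ʳ b M (suc (suc y)))) (cong ((suc b , c) ∷_) (z-middle (suc y)))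
  fitsM : All Fits (zip M cM)
  fitsM = ++⁻ˡ (zip M cM) (subst (All Fits) (z-middle (suc (suc y))) fits)
  lastNotFull : suc y ≤ cl
  lastNotFull with ++⁻ʳ (zip M cM) (subst (All Fits) (z-middle (suc (suc y))) fits)
  ... | s≤s f ∷ [] = f
  closed : UpperClosed ((suc b , c) ∷ zip M cM ∷ʳ (suc y , cl))
  closed = UpperClosed-∷ʳ ((suc b , c) ∷ zip M cM) (suc y , cl)
             (s≤s z≤n ∷ ++⁺ (All-zip-proj₁ M cM pos) (s≤s z≤n ∷ [])) lastNotFull
  fitsImage : All Fits ((suc b , c) ∷ zip M cM ∷ʳ (suc y , cl))
  fitsImage = s≤s nf ∷ ++⁺ fitsM (m≤n⇒m≤1+n lastNotFull ∷ [])

data UnitCapacities (B : List ℕ) (t : ℕ) (D : List ℕ) : List ℕ → Set where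
  capacities : (cB cT : List ℕ) (c : ℕ) (cD : List ℕ) →
               length cB ≡ length B → length cT ≡ t → length cD ≡ length D →
               UnitCapacities B t D (cB ++ cT ++ c ∷ cD)

unitCapacities : (B : List ℕ) (t : ℕ) (D cs : List ℕ) → length cs ≡ length (B ++ replicate t 1 ++ 0 ∷ D) →
                 UnitCapacities B t D cs
unitCapacities (b ∷ B) t       D (c ∷ cs) eq with unitCapacities B t D cs (suc-injective eq)
... | capacities cB cT c₀ cD eB eT eD = capacities (c ∷ cB) cT c₀ cD (cong suc eB) eT eD
unitCapacities []      (suc t) D (c ∷ cs) eq with unitCapacities [] t D cs (suc-injective eq)
... | capacities [] cT c₀ cD _ eT eD = capacities [] (c ∷ cT) c₀ cD refl (cong suc eT) eD
unitCapacities []      zero    D (c ∷ cs) eq = capacities [] [] c cs refl refl (suc-injective eq)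

zip-unit : (B : List ℕ) (t : ℕ) (D cB cT : List ℕ) (c : ℕ) (cD : List ℕ) → length cB ≡ length B → length cT ≡ t →
           zip (B ++ replicate t 1 ++ 0 ∷ D) (cB ++ cT ++ c ∷ cD) ≡ zip B cB ++ zip (replicate t 1) cT ++ (0 , c) ∷ zip D cD
zip-unit B t D cB cT c cD eB eT = trans (zip-++ B _ cB _ (sym eB))
  (cong (zip B cB ++_) (zip-++ (replicate t 1) (0 ∷ D) cT (c ∷ cD) (trans (length-replicate t) (sym eT))))

zip-unitImage : (P : List ℕ) (t : ℕ) (L cB cT : List ℕ) (c : ℕ) (cD : List ℕ) → length P ≡ length cB → length cT ≡ t →
                zip ((P ++ 0 ∷ replicate t 1) ++ L) (cB ++ cT ++ c ∷ cD) ≡ zip P cB ++ zip (0 ∷ replicate t 1) (cT ∷ʳ c) ++ zip L cD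
zip-unitImage P t L cB cT c cD eP eT = begin
  zip ((P ++ 0 ∷ replicate t 1) ++ L) (cB ++ cT ++ c ∷ cD)
    ≡⟨ cong₂ zip (++-assoc P _ L) (cong (cB ++_) (sym (++-assoc cT (c ∷ []) cD))) ⟩
  zip (P ++ (0 ∷ replicate t 1) ++ L) (cB ++ (cT ∷ʳ c) ++ cD)
    ≡⟨ zip-++ P _ cB _ eP ⟩
  zip P cB ++ zip ((0 ∷ replicate t 1) ++ L) ((cT ∷ʳ c) ++ cD)
    ≡⟨ cong (zip P cB ++_) (zip-++ (0 ∷ replicate t 1) L (cT ∷ʳ c) cD length-zeroOnes) ⟩
  zip P cB ++ zip (0 ∷ replicate t 1) (cT ∷ʳ c) ++ zip L cD ∎
  where
  length-zeroOnes : length (0 ∷ replicate t 1) ≡ length (cT ∷ʳ c)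
  length-zeroOnes = trans (cong suc (trans (length-replicate t) (sym eT))) (sym (length-∷ʳ cT c))

headNotFull-afterZero : (c₀ : ℕ) (Z Y : List (ℕ × ℕ)) → Linked LowerLink ((0 , c₀) ∷ Z ++ Y) → HeadNotFull Z
headNotFull-afterZero c₀ []      _ _       = tt
headNotFull-afterZero c₀ (z ∷ Z) _ (r ∷ _) = r refl

linProc-upperClosed : {D : List ℕ} (u : Units D) (cs : List ℕ) → length cs ≡ length D → Positive cs →
  (c₀ : ℕ) → Linked LowerLink ((0 , c₀) ∷ zip D cs) → All Fits (zip D cs) →
  UpperClosed (zip (linProc [] D) cs) × All Fits (zip (linProc [] D) cs)
linProc-upperClosed []                      cs _  _    _  _  _    = UpperClosed-[] , []
linProc-upperClosed (unit R t {D} pos h u) cs eq cpos c₀ lk fits with unitCapacities (reverse R) t D cs eq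
... | capacities cB cT c cD eB eT eD =
  subst (λ Z → UpperClosed Z × All Fits Z) (sym output)
    ( UpperClosed-++ ZP _ (proj₁ block) (UpperClosed-++ ZO ZL (UpperClosed-zeroOnes t (cT ∷ʳ c) cposO) (proj₁ rest))
    , ++⁺ (proj₂ block) (++⁺ (Fits-zeroOnes t (cT ∷ʳ c)) (proj₂ rest)))
  where
  B′ P : List ℕ
  B′ = reverse R
  P  = p2 B′
  ZB ZT ZP ZO ZL : List (ℕ × ℕ)
  ZB = zip B′ cB
  ZT = zip (replicate t 1) cT
  ZP = zip P cB
  ZO = zip (0 ∷ replicate t 1) (cT ∷ʳ c)
  ZL = zip (linProc [] D) cD
  output : zip (linProc [] (B′ ++ replicate t 1 ++ 0 ∷ D)) (cB ++ cT ++ c ∷ cD) ≡ ZP ++ ZO ++ ZL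
  output = trans (cong (λ xs → zip xs (cB ++ cT ++ c ∷ cD)) (linProc-unit R t D pos h))
                 (zip-unitImage P t (linProc [] D) cB cT c cD (trans (length-p2 B′) (sym eB)) eT)
  lk′ : Linked LowerLink ((0 , c₀) ∷ ZB ++ ZT ++ (0 , c) ∷ zip D cD)
  lk′ = subst (λ Z → Linked LowerLink ((0 , c₀) ∷ Z)) (zip-unit B′ t D cB cT c cD eB eT) lk
  fits′ : All Fits (ZB ++ ZT ++ (0 , c) ∷ zip D cD)
  fits′ = subst (All Fits) (zip-unit B′ t D cB cT c cD eB eT) fits
  block : UpperClosed ZP × All Fits ZP
  block = p2-upperClosed (blockShape R pos h) cB eB (headNotFull-afterZero c₀ ZB _ lk′) (++⁻ˡ ZB fits′)
  cposO : Positive (cT ∷ʳ c)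
  cposO with ++⁻ʳ cB cpos
  ... | cposTD = ++⁺ (++⁻ˡ cT cposTD) (All.head (++⁻ʳ cT cposTD) ∷ [])
  rest : UpperClosed ZL × All Fits ZL
  rest = linProc-upperClosed u cD eD (All.tail (++⁻ʳ cT (++⁻ʳ cB cpos))) c
           (Linked-++⁻ʳ ZT (Linked-++⁻ʳ ((0 , c₀) ∷ ZB) lk′)) (All.tail (++⁻ʳ ZT (++⁻ʳ ZB fits′)))

linProc-upper : (X cs : List ℕ) → length cs ≡ length (X ∷ʳ 0) → Positive cs →
                LowerSeq cs (X ∷ʳ 0) → UpperSeq cs (linProc [] (X ∷ʳ 0))
linProc-upper X cs eq cpos (cyc , fits) with ∷ʳ-split cs (length X) (trans eq (length-∷ʳ X 0))
... | cX , c₀ , refl , lenX = UpperClosed⇒Cyclic _ (proj₁ closed) , proj₂ closed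
  where
  zipD : zip (X ∷ʳ 0) (cX ∷ʳ c₀) ≡ zip X cX ∷ʳ (0 , c₀)
  zipD = zip-++ X (0 ∷ []) cX (c₀ ∷ []) (sym lenX)
  afterZero : Linked LowerLink ((0 , c₀) ∷ zip (X ∷ʳ 0) (cX ∷ʳ c₀))
  afterZero = subst (λ Z → Linked LowerLink ((0 , c₀) ∷ Z)) (sym zipD)
    (subst (Cyclic LowerLink) (rotate-++ (zip X cX) ((0 , c₀) ∷ []))
      (Cyclic-rotate (length (zip X cX)) _ (subst (Cyclic LowerLink) zipD cyc)))
  closed : UpperClosed (zip (linProc [] (X ∷ʳ 0)) (cX ∷ʳ c₀)) × All Fits (zip (linProc [] (X ∷ʳ 0)) (cX ∷ʳ c₀))
  closed = linProc-upperClosed (unitsOf X) (cX ∷ʳ c₀) eq cpos c₀ afterZero fits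

phiSeq-upper : (cs d : List ℕ) → length d ≡ length cs → Positive cs → LowerSeq cs d → UpperSeq cs (phiSeq d)
phiSeq-upper cs d eq cpos low with phiView d
... | positive pos φd≡d = subst (UpperSeq cs) (sym φd≡d) (Cyclic-upper-positive _ (All-zip-proj₁ d cs pos) , proj₂ low)
... | rotated k X refl φd≡ = subst (UpperSeq cs) (sym φd≡) (subst (CyclicFit UpperLink) (sym zipL) (CyclicFit-rotate k _ upper))
  where
  D : List ℕ
  D = X ∷ʳ 0
  L : List ℕ
  L = linProc [] D
  m : ℕ
  m = k * (length cs ∸ 1)
  cD : List ℕ
  cD = rotate m cs
  lenD : length D ≡ length cs
  lenD = trans (sym (length-rotate k D)) eq
  lenL : length L ≡ length cs
  lenL = trans (length-linProc (unitsOf X)) lenD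
  zipD : zip (rotate k D) cs ≡ rotate k (zip D cD)
  zipD = zip-rotateˡ k D cs lenD
  zipL : zip (rotate k L) cs ≡ rotate k (zip L cD)
  zipL = zip-rotateˡ k L cs lenL
  lower : LowerSeq cD D
  lower = unrotate (CyclicFit LowerLink) CyclicFit-rotate k (zip D cD) (subst (CyclicFit LowerLink) zipD low)
  upper : UpperSeq cD L
  upper = linProc-upper X cD (trans (length-rotate m cs) (sym lenD)) (All-resp-↭ (↭-sym (rotate-↭ m cs)) cpos) lower

reverse-phiSeq-reverse-lower : (cs e : List ℕ) → length e ≡ length cs → Positive cs → UpperSeq cs e →
                               LowerSeq cs (reverse (phiSeq (reverse e)))
reverse-phiSeq-reverse-lower cs e eq cpos up = subst (λ cs′ → LowerSeq cs′ (reverse (phiSeq (reverse e)))) (reverse-involutive cs)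
  (UpperSeq-reverse (reverse cs) (phiSeq (reverse e)) (trans (length-phiSeq (reverse e)) length-reversed)
    (phiSeq-upper (reverse cs) (reverse e) length-reversed (Positive-reverse cpos) (UpperSeq-reverse cs e eq up)))
  where
  length-reversed : length (reverse e) ≡ length (reverse cs)
  length-reversed = trans (length-reverse e) (trans eq (sym (length-reverse cs)))

module _ {k : ℕ} (δ : Fin (suc k) → ℕ) where

  CyclicFit-tabulate⁺ : {R : ℕ × ℕ → ℕ × ℕ → Set} (f : Fin (suc k) → ℕ) →
    (∀ i → R (f (prevC i) , δ (prevC i)) (f i , δ i)) → (∀ i → f i ≤ suc (δ i)) → CyclicFit R (zip (tabulate f) (tabulate δ))
  CyclicFit-tabulate⁺ f links fits = subst (CyclicFit _) (sym (zip-tabulate f δ))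
    (Cyclic-tabulate⁺ k (λ i → f i , δ i) links , tabulate⁺ fits)

  CyclicFit-tabulate⁻ : {R : ℕ × ℕ → ℕ × ℕ → Set} (f : Fin (suc k) → ℕ) → CyclicFit R (zip (tabulate f) (tabulate δ)) →
    (∀ i → R (f (prevC i) , δ (prevC i)) (f i , δ i)) × (∀ i → f i ≤ suc (δ i))
  CyclicFit-tabulate⁻ f cf with subst (CyclicFit _) (zip-tabulate f δ) cf
  ... | c , fits = Cyclic-tabulate⁻ k (λ i → f i , δ i) c , tabulate⁻ fits

-- Counting along a chain

⌊⌋-true : {P : Set} (p? : Dec P) → P → ⌊ p? ⌋ ≡ true
⌊⌋-true (yes _) _ = refl
⌊⌋-true (no ¬p) p = ⊥-elim (¬p p)

⌊⌋-false : {P : Set} (p? : Dec P) → ¬ P → ⌊ p? ⌋ ≡ false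
⌊⌋-false (yes p) ¬p = ⊥-elim (¬p p)
⌊⌋-false (no _)  _  = refl

⌊⌋-true⁻ : {P : Set} (p? : Dec P) → ⌊ p? ⌋ ≡ true → P
⌊⌋-true⁻ (yes p) _ = p

⌊suc≤?suc⌋ : (a b : ℕ) → ⌊ suc a ≤? suc b ⌋ ≡ ⌊ a ≤? b ⌋
⌊suc≤?suc⌋ a b with a ≤? b
... | yes a≤b = ⌊⌋-true (suc a ≤? suc b) (s≤s a≤b)
... | no a≰b  = ⌊⌋-false (suc a ≤? suc b) (a≰b ∘ s≤s⁻¹)

countTrue-≤ : (n : ℕ) (f : Fin n → Bool) → countTrue (tabulate f) ≤ n
countTrue-≤ n f = subst (countTrue (tabulate f) ≤_) (length-tabulate f) (countTrue≤length (tabulate f))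
  where
  countTrue≤length : (bs : List Bool) → countTrue bs ≤ length bs
  countTrue≤length []           = z≤n
  countTrue≤length (true ∷ bs)  = s≤s (countTrue≤length bs)
  countTrue≤length (false ∷ bs) = m≤n⇒m≤1+n (countTrue≤length bs)

countTrue-floor : (n c : ℕ) → c ≤ n → countTrue (tabulate {n = n} (λ j → ⌊ suc (toℕ j) ≤? c ⌋)) ≡ c
countTrue-floor zero    zero    _       = refl
countTrue-floor (suc n) zero    _       = none n
  where
  none : (n : ℕ) → countTrue (tabulate {n = n} (λ j → ⌊ suc (suc (toℕ j)) ≤? 0 ⌋)) ≡ 0
  none zero    = refl
  none (suc n) = none n
countTrue-floor (suc n) (suc c) (s≤s c≤n) =
  cong suc (trans (cong countTrue (tabulate-cong {n = n} (λ j → ⌊suc≤?suc⌋ (suc (toℕ j)) c))) (countTrue-floor n c c≤n))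

countTrue-ceiling : (n c e : ℕ) → countTrue (tabulate {n = n} (λ j → ⌊ c ≤? toℕ j + e ⌋)) ≡ n ∸ (c ∸ e)
countTrue-ceiling zero    c e = sym (0∸n≡0 (c ∸ e))
countTrue-ceiling (suc n) c e = step (c ≤? e)
  where
  rest : countTrue (tabulate {n = n} (λ j → ⌊ c ≤? suc (toℕ j) + e ⌋)) ≡ n ∸ (c ∸ suc e)
  rest = trans (cong countTrue (tabulate-cong {n = n} (λ j → cong (λ z → ⌊ c ≤? z ⌋) (sym (+-suc (toℕ j) e)))))
               (countTrue-ceiling n c (suc e))
  ∸-suc : (c e : ℕ) → e < c → c ∸ e ≡ suc (c ∸ suc e)
  ∸-suc (suc c) zero    _         = refl
  ∸-suc (suc c) (suc e) (s≤s e<c) = ∸-suc c e e<c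
  step : (c≤?e : Dec (c ≤ e)) →
         countTrue (⌊ c≤?e ⌋ ∷ tabulate {n = n} (λ j → ⌊ c ≤? suc (toℕ j) + e ⌋)) ≡ suc n ∸ (c ∸ e)
  step (yes c≤e) = begin
    suc (countTrue (tabulate {n = n} (λ j → ⌊ c ≤? suc (toℕ j) + e ⌋)))
      ≡⟨ cong suc rest ⟩
    suc (n ∸ (c ∸ suc e))
      ≡⟨ cong (λ z → suc (n ∸ z)) (m≤n⇒m∸n≡0 (m≤n⇒m≤1+n c≤e)) ⟩
    suc n
      ≡⟨ cong (suc n ∸_) (m≤n⇒m∸n≡0 c≤e) ⟨
    suc n ∸ (c ∸ e)
      ∎
  step (no c≰e) = trans rest (cong (suc n ∸_) (sym (∸-suc c e (≰⇒> c≰e))))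

singleton-threshold : (b : Bool) → b ≡ ⌊ 1 ≤? countTrue (b ∷ []) ⌋
singleton-threshold true  = refl
singleton-threshold false = refl

downClosed-threshold : (m : ℕ) (f : Fin (suc m) → Bool) → (∀ (j : Fin m) → f (suc j) ≡ true → f (inject₁ j) ≡ true) →
                       ∀ j → f j ≡ ⌊ suc (toℕ j) ≤? countTrue (tabulate f) ⌋
downClosed-threshold zero    f _      zero = singleton-threshold (f zero)
downClosed-threshold (suc m) f closed j = threshold (f zero) refl j
  where
  g : Fin (suc m) → Bool
  g = f ∘ suc
  c : ℕ
  c = countTrue (tabulate g)
  IH : ∀ j → g j ≡ ⌊ suc (toℕ j) ≤? c ⌋
  IH = downClosed-threshold m g (λ j → closed (suc j))
  nothing-after : f zero ≡ false → ¬ (1 ≤ c)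
  nothing-after f0 1≤c with trans (sym f0) (closed zero (trans (IH zero) (⌊⌋-true (1 ≤? c) 1≤c)))
  ... | ()
  threshold : (b : Bool) → f zero ≡ b → ∀ j → f j ≡ ⌊ suc (toℕ j) ≤? countTrue (b ∷ tabulate g) ⌋
  threshold true  f0 zero    = f0
  threshold true  f0 (suc j) = trans (IH j) (sym (⌊suc≤?suc⌋ (suc (toℕ j)) c))
  threshold false f0 zero    = trans f0 (sym (⌊⌋-false (1 ≤? c) (nothing-after f0)))
  threshold false f0 (suc j) = trans (IH j) (trans (⌊⌋-false _ (none (toℕ j))) (sym (⌊⌋-false _ (none (suc (toℕ j))))))
    where
    none : ∀ n → ¬ (suc n ≤ c)
    none n = nothing-after f0 ∘ ≤-trans (s≤s z≤n)

upClosed-threshold : (m : ℕ) (f : Fin (suc m) → Bool) → (∀ (j : Fin m) → f (inject₁ j) ≡ true → f (suc j) ≡ true) →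
                     ∀ j → f j ≡ ⌊ suc m ≤? toℕ j + countTrue (tabulate f) ⌋
upClosed-threshold zero    f _      zero = singleton-threshold (f zero)
upClosed-threshold (suc m) f closed j = threshold (f zero) refl j
  where
  g : Fin (suc m) → Bool
  g = f ∘ suc
  c : ℕ
  c = countTrue (tabulate g)
  IH : ∀ j → g j ≡ ⌊ suc m ≤? toℕ j + c ⌋
  IH = upClosed-threshold m g (λ j → closed (suc j))
  threshold : (b : Bool) → f zero ≡ b → ∀ j → f j ≡ ⌊ suc (suc m) ≤? toℕ j + countTrue (b ∷ tabulate g) ⌋
  threshold true  f0 j = trans (all j) (sym (⌊⌋-true _ (≤-trans (s≤s full) (m≤n+m (suc c) (toℕ j)))))
    where
    full : suc m ≤ c
    full = ⌊⌋-true⁻ (suc m ≤? 0 + c) (trans (sym (IH zero)) (closed zero f0))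
    all : ∀ j → f j ≡ true
    all zero    = f0
    all (suc j) = trans (IH j) (⌊⌋-true _ (≤-trans full (m≤n+m c (toℕ j))))
  threshold false f0 zero    = trans f0 (sym (⌊⌋-false _ (λ q → 1+n≰n (≤-trans q (countTrue-≤ (suc m) g)))))
  threshold false f0 (suc j) = trans (IH j) (sym (⌊suc≤?suc⌋ (suc m) (toℕ j + c)))

-- Order ideals of the circular fence, chain by chain

at : {ℓ : ℕ} → List ℕ → Fin ℓ → ℕ
at xs i = nth xs (toℕ i)

module _ {ℓ : ℕ} {δ : Fin ℓ → ℕ} where

  counts : Subset ℓ δ → List ℕ
  counts S = map (countIn ℓ δ S) (allFin ℓ)

  counts-tabulate : (S : Subset ℓ δ) → counts S ≡ tabulate (countIn ℓ δ S)
  counts-tabulate S = map-tabulate (λ i → i) (countIn ℓ δ S)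

  at-counts : (S : Subset ℓ δ) (i : Fin ℓ) → at (counts S) i ≡ countIn ℓ δ S i
  at-counts S i = trans (cong (λ xs → nth xs (toℕ i)) (counts-tabulate S)) (nth-tabulate (countIn ℓ δ S) i)

  length-counts : (S : Subset ℓ δ) → length (counts S) ≡ ℓ
  length-counts S = trans (cong length (counts-tabulate S)) (length-tabulate (countIn ℓ δ S))

  countIn-tabulate : (S : Subset ℓ δ) (i : Fin ℓ) → countIn ℓ δ S i ≡ countTrue (tabulate (λ j → S (i , j)))
  countIn-tabulate S i = cong countTrue (map-tabulate (λ j → j) (λ j → S (i , j)))

  countIn-≤ : (S : Subset ℓ δ) (i : Fin ℓ) → countIn ℓ δ S i ≤ suc (δ i)
  countIn-≤ S i = subst (_≤ suc (δ i)) (sym (countIn-tabulate S i)) (countTrue-≤ (suc (δ i)) (λ j → S (i , j)))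

  countIn-cong : (S S′ : Subset ℓ δ) → (∀ x → S x ≡ S′ x) → ∀ i → countIn ℓ δ S i ≡ countIn ℓ δ S′ i
  countIn-cong S S′ S≗S′ i = cong countTrue (map-cong (λ j → S≗S′ (i , j)) (allFin (suc (δ i))))

  counts-cong : (S S′ : Subset ℓ δ) → (∀ x → S x ≡ S′ x) → counts S ≡ counts S′
  counts-cong S S′ S≗S′ = map-cong (countIn-cong S S′ S≗S′) (allFin ℓ)

  countIn-floorSet : (d : Fin ℓ → ℕ) (i : Fin ℓ) → d i ≤ suc (δ i) → countIn ℓ δ (floorSet ℓ δ d) i ≡ d i
  countIn-floorSet d i d≤ = trans (countIn-tabulate (floorSet ℓ δ d) i) (countTrue-floor (suc (δ i)) (d i) d≤)

  countIn-ceilSet : (e : Fin ℓ → ℕ) (i : Fin ℓ) → e i ≤ suc (δ i) → countIn ℓ δ (ceilSet ℓ δ e) i ≡ e i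
  countIn-ceilSet e i e≤ = trans (countIn-tabulate (ceilSet ℓ δ e) i)
    (trans (countTrue-ceiling (suc (δ i)) (suc (δ i)) (e i)) (m∸[m∸n]≡n e≤))

  lowerIdeal≡floorSet : (I : Subset ℓ δ) → IsLowerIdeal ℓ δ I → ∀ x → I x ≡ floorSet ℓ δ (countIn ℓ δ I) x
  lowerIdeal≡floorSet I low (i , j) =
    trans (downClosed-threshold (δ i) (λ j → I (i , j)) (λ j → low (i , suc j) (i , inject₁ j) (chain i j ◅ ε)) j)
          (cong (λ c → ⌊ suc (toℕ j) ≤? c ⌋) (sym (countIn-tabulate I i)))

  filter≡ceilSet : (U : Subset ℓ δ) → IsFilter ℓ δ U → ∀ x → U x ≡ ceilSet ℓ δ (countIn ℓ δ U) x
  filter≡ceilSet U fil (i , j) =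
    trans (upClosed-threshold (δ i) (λ j → U (i , j)) (λ j → fil (i , inject₁ j) (i , suc j) (chain i j ◅ ε)) j)
          (cong (λ c → ⌊ suc (δ i) ≤? toℕ j + c ⌋) (sym (countIn-tabulate U i)))

  lowerIdeal-fromCovers : (I : Subset ℓ δ) → (∀ x y → Cover ℓ δ x y → I y ≡ true → I x ≡ true) → IsLowerIdeal ℓ δ I
  lowerIdeal-fromCovers I covers x y y≤x Ix = down y≤x Ix
    where
    down : ∀ {y x} → Leq ℓ δ y x → I x ≡ true → I y ≡ true
    down ε         Ix = Ix
    down (c ◅ y≤x) Ix = covers _ _ c (down y≤x Ix)

  filter-fromCovers : (U : Subset ℓ δ) → (∀ x y → Cover ℓ δ x y → U x ≡ true → U y ≡ true) → IsFilter ℓ δ U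
  filter-fromCovers U covers x y x≤y Ux = up x≤y Ux
    where
    up : ∀ {x y} → Leq ℓ δ x y → U x ≡ true → U y ≡ true
    up ε         Ux = Ux
    up (c ◅ x≤y) Ux = up x≤y (covers _ _ c Ux)

  -- If the maximum of D_i lies in I, so does the minimum of D_(i-1).
  lowerIdeal-link : (I : Subset ℓ δ) → IsLowerIdeal ℓ δ I → ∀ i → countIn ℓ δ I (prevC i) ≡ 0 → countIn ℓ δ I i ≤ δ i
  lowerIdeal-link I low i c≡0 with countIn ℓ δ I i ≤? δ i
  ... | yes c≤δ = c≤δ
  ... | no  c≰δ = ⊥-elim (n>0⇒n≢0 bottom c≡0)
    where
    top : I (i , fromℕ (δ i)) ≡ true
    top = trans (lowerIdeal≡floorSet I low (i , fromℕ (δ i)))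
                (⌊⌋-true _ (subst (λ n → suc n ≤ countIn ℓ δ I i) (sym (toℕ-fromℕ (δ i))) (≰⇒> c≰δ)))
    bottom : 1 ≤ countIn ℓ δ I (prevC i)
    bottom = ⌊⌋-true⁻ _ (trans (sym (lowerIdeal≡floorSet I low (prevC i , zero)))
                               (low (i , fromℕ (δ i)) (prevC i , zero) (link i ◅ ε) top))

  filter-link : (U : Subset ℓ δ) → IsFilter ℓ δ U → ∀ i → countIn ℓ δ U i ≡ 0 → countIn ℓ δ U (prevC i) ≤ δ (prevC i)
  filter-link U fil i c≡0 with countIn ℓ δ U (prevC i) ≤? δ (prevC i)
  ... | yes c≤δ = c≤δ
  ... | no  c≰δ = ⊥-elim (1+n≰n (subst (suc (δ i) ≤_) top≡ (⌊⌋-true⁻ _ top)))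
    where
    bottom : U (prevC i , zero) ≡ true
    bottom = trans (filter≡ceilSet U fil (prevC i , zero)) (⌊⌋-true _ (≰⇒> c≰δ))
    top : ⌊ suc (δ i) ≤? toℕ (fromℕ (δ i)) + countIn ℓ δ U i ⌋ ≡ true
    top = trans (sym (filter≡ceilSet U fil (i , fromℕ (δ i)))) (fil (prevC i , zero) (i , fromℕ (δ i)) (link i ◅ ε) bottom)
    top≡ : toℕ (fromℕ (δ i)) + countIn ℓ δ U i ≡ δ i
    top≡ = trans (cong₂ _+_ (toℕ-fromℕ (δ i)) c≡0) (+-identityʳ (δ i))

  floorSet-lowerIdeal : (d : Fin ℓ → ℕ) → (∀ i → d (prevC i) ≡ 0 → d i ≤ δ i) → IsLowerIdeal ℓ δ (floorSet ℓ δ d)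
  floorSet-lowerIdeal d links = lowerIdeal-fromCovers (floorSet ℓ δ d) covers
    where
    covers : ∀ x y → Cover ℓ δ x y → floorSet ℓ δ d y ≡ true → floorSet ℓ δ d x ≡ true
    covers _ _ (chain i j) in-y = ⌊⌋-true _
      (subst (λ n → suc n ≤ d i) (sym (toℕ-inject₁ j)) (≤-trans (n≤1+n (suc (toℕ j))) (⌊⌋-true⁻ _ in-y)))
    covers _ _ (link i) in-y with d (prevC i) in eq
    ... | zero  = ⊥-elim (1+n≰n (≤-trans (subst (λ n → suc n ≤ d i) (toℕ-fromℕ (δ i)) (⌊⌋-true⁻ _ in-y)) (links i eq)))
    ... | suc _ = refl

  ceilSet-filter : (e : Fin ℓ → ℕ) → (∀ i → e i ≡ 0 → e (prevC i) ≤ δ (prevC i)) → IsFilter ℓ δ (ceilSet ℓ δ e)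
  ceilSet-filter e links = filter-fromCovers (ceilSet ℓ δ e) covers
    where
    covers : ∀ x y → Cover ℓ δ x y → ceilSet ℓ δ e x ≡ true → ceilSet ℓ δ e y ≡ true
    covers _ _ (chain i j) in-x = ⌊⌋-true _
      (≤-trans (⌊⌋-true⁻ _ in-x) (+-monoˡ-≤ (e i) (subst (_≤ suc (toℕ j)) (sym (toℕ-inject₁ j)) (n≤1+n (toℕ j)))))
    covers _ _ (link i) in-x with e i in eq
    ... | zero  = ⊥-elim (1+n≰n (≤-trans (⌊⌋-true⁻ _ in-x) (links i eq)))
    ... | suc n = ⌊⌋-true _ (subst (λ m → suc (δ i) ≤ m + suc n) (sym (toℕ-fromℕ (δ i)))
                                   (subst (suc (δ i) ≤_) (sym (+-suc (δ i) n)) (s≤s (m≤m+n (δ i) n))))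

-- The map φ̄

module PhiBar (k : ℕ) (δ : Fin (suc k) → ℕ) (δ-positive : ∀ i → 1 ≤ δ i) where

  length-capacities : length (tabulate δ) ≡ suc k
  length-capacities = length-tabulate δ

  counts-lower : (I : Subset (suc k) δ) → IsLowerIdeal (suc k) δ I → LowerSeq (tabulate δ) (counts I)
  counts-lower I low = subst (LowerSeq (tabulate δ)) (sym (counts-tabulate I))
    (CyclicFit-tabulate⁺ δ (countIn (suc k) δ I) (lowerIdeal-link I low) (countIn-≤ I))

  counts-upper : (U : Subset (suc k) δ) → IsFilter (suc k) δ U → UpperSeq (tabulate δ) (counts U)
  counts-upper U fil = subst (UpperSeq (tabulate δ)) (sym (counts-tabulate U))
    (CyclicFit-tabulate⁺ δ (countIn (suc k) δ U) (filter-link U fil) (countIn-≤ U))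

  floorSet-lower : (d : List ℕ) → length d ≡ suc k → LowerSeq (tabulate δ) d →
                   IsLowerIdeal (suc k) δ (floorSet (suc k) δ (at d)) × counts (floorSet (suc k) δ (at d)) ≡ d
  floorSet-lower d len low with CyclicFit-tabulate⁻ δ (at d) (subst (LowerSeq (tabulate δ)) (sym (tabulate-nth (suc k) d len)) low)
  ... | links , fits = floorSet-lowerIdeal {δ = δ} (at d) links , (begin
    counts (floorSet (suc k) δ (at d))
      ≡⟨ counts-tabulate (floorSet (suc k) δ (at d)) ⟩
    tabulate (countIn (suc k) δ (floorSet (suc k) δ (at d)))
      ≡⟨ tabulate-cong (λ i → countIn-floorSet {δ = δ} (at d) i (fits i)) ⟩
    tabulate (at d)
      ≡⟨ tabulate-nth (suc k) d len ⟩
    d ∎)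

  ceilSet-upper : (e : List ℕ) → length e ≡ suc k → UpperSeq (tabulate δ) e →
                  IsFilter (suc k) δ (ceilSet (suc k) δ (at e)) × counts (ceilSet (suc k) δ (at e)) ≡ e
  ceilSet-upper e len up with CyclicFit-tabulate⁻ δ (at e) (subst (UpperSeq (tabulate δ)) (sym (tabulate-nth (suc k) e len)) up)
  ... | links , fits = ceilSet-filter {δ = δ} (at e) links , (begin
    counts (ceilSet (suc k) δ (at e))
      ≡⟨ counts-tabulate (ceilSet (suc k) δ (at e)) ⟩
    tabulate (countIn (suc k) δ (ceilSet (suc k) δ (at e)))
      ≡⟨ tabulate-cong (λ i → countIn-ceilSet {δ = δ} (at e) i (fits i)) ⟩
    tabulate (at e)
      ≡⟨ tabulate-nth (suc k) e len ⟩
    e ∎)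

  phiBar-filter : (I : Subset (suc k) δ) → IsLowerIdeal (suc k) δ I →
                  IsFilter (suc k) δ (phiBar (suc k) δ I) × counts (phiBar (suc k) δ I) ≡ phiSeq (counts I)
  phiBar-filter I low = ceilSet-upper (phiSeq (counts I)) (trans (length-phiSeq (counts I)) (length-counts I))
    (phiSeq-upper (tabulate δ) (counts I) (trans (length-counts I) (sym length-capacities)) (tabulate⁺ δ-positive) (counts-lower I low))

  phiBar-isFilter : (I : Subset (suc k) δ) → IsLowerIdeal (suc k) δ I → IsFilter (suc k) δ (phiBar (suc k) δ I)
  phiBar-isFilter I low = proj₁ (phiBar-filter I low)

  card-phiBar : (I : Subset (suc k) δ) → IsLowerIdeal (suc k) δ I → card (suc k) δ (phiBar (suc k) δ I) ≡ card (suc k) δ I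
  card-phiBar I low = trans (cong sum (proj₂ (phiBar-filter I low))) (sum-phiSeq (counts I))

  lowerIdeal-counts-injective : (I J : Subset (suc k) δ) → IsLowerIdeal (suc k) δ I → IsLowerIdeal (suc k) δ J →
                                counts I ≡ counts J → ∀ x → I x ≡ J x
  lowerIdeal-counts-injective I J lowI lowJ eq (i , j) = begin
    I (i , j)                                        ≡⟨ lowerIdeal≡floorSet I lowI (i , j) ⟩
    ⌊ suc (toℕ j) ≤? countIn (suc k) δ I i ⌋         ≡⟨ cong (λ c → ⌊ suc (toℕ j) ≤? c ⌋) same-count ⟩
    ⌊ suc (toℕ j) ≤? countIn (suc k) δ J i ⌋         ≡⟨ lowerIdeal≡floorSet J lowJ (i , j) ⟨
    J (i , j)                                        ∎
    where
    same-count : countIn (suc k) δ I i ≡ countIn (suc k) δ J i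
    same-count = trans (sym (at-counts I i)) (trans (cong (λ xs → at xs i) eq) (at-counts J i))

  phiBar-injective : (I J : Subset (suc k) δ) → IsLowerIdeal (suc k) δ I → IsLowerIdeal (suc k) δ J →
                     (∀ x → phiBar (suc k) δ I x ≡ phiBar (suc k) δ J x) → ∀ x → I x ≡ J x
  phiBar-injective I J lowI lowJ same = lowerIdeal-counts-injective I J lowI lowJ (phiSeq-injective (counts I) (counts J) (begin
    phiSeq (counts I)            ≡⟨ proj₂ (phiBar-filter I lowI) ⟨
    counts (phiBar (suc k) δ I)  ≡⟨ counts-cong (phiBar (suc k) δ I) (phiBar (suc k) δ J) same ⟩
    counts (phiBar (suc k) δ J)  ≡⟨ proj₂ (phiBar-filter J lowJ) ⟩
    phiSeq (counts J)            ∎))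

  phiBar-surjective : (U : Subset (suc k) δ) → IsFilter (suc k) δ U →
                      Σ (Subset (suc k) δ) (λ I → IsLowerIdeal (suc k) δ I × (∀ x → phiBar (suc k) δ I x ≡ U x))
  phiBar-surjective U fil = floorSet (suc k) δ (at d) , proj₁ preimage , hits
    where
    e d : List ℕ
    e = counts U
    d = reverse (phiSeq (reverse e))
    length-d : length d ≡ suc k
    length-d = trans (length-reverse (phiSeq (reverse e))) (trans (length-phiSeq (reverse e)) (trans (length-reverse e) (length-counts U)))
    preimage : IsLowerIdeal (suc k) δ (floorSet (suc k) δ (at d)) × counts (floorSet (suc k) δ (at d)) ≡ d
    preimage = floorSet-lower d length-d
      (reverse-phiSeq-reverse-lower (tabulate δ) e (trans (length-counts U) (sym length-capacities)) (tabulate⁺ δ-positive) (counts-upper U fil))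
    hits : ∀ x → phiBar (suc k) δ (floorSet (suc k) δ (at d)) x ≡ U x
    hits (i , j) = begin
      ⌊ suc (δ i) ≤? toℕ j + at (phiSeq (counts (floorSet (suc k) δ (at d)))) i ⌋
        ≡⟨ cong (λ xs → ⌊ suc (δ i) ≤? toℕ j + at (phiSeq xs) i ⌋) (proj₂ preimage) ⟩
      ⌊ suc (δ i) ≤? toℕ j + at (phiSeq d) i ⌋
        ≡⟨ cong (λ xs → ⌊ suc (δ i) ≤? toℕ j + at xs i ⌋) (phiSeq-reverse-phiSeq-reverse e) ⟩
      ⌊ suc (δ i) ≤? toℕ j + at e i ⌋
        ≡⟨ cong (λ c → ⌊ suc (δ i) ≤? toℕ j + c ⌋) (at-counts U i) ⟩
      ⌊ suc (δ i) ≤? toℕ j + countIn (suc k) δ U i ⌋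
        ≡⟨ filter≡ceilSet U fil (i , j) ⟨
      U (i , j)
        ∎

theorem3p1 : (ℓ : ℕ) → 1 ≤ ℓ → (δ : Fin ℓ → ℕ) → (∀ i → 1 ≤ δ i) →
    ((I : Subset ℓ δ) → IsLowerIdeal ℓ δ I → IsFilter ℓ δ (phiBar ℓ δ I))
    × ((I : Subset ℓ δ) → IsLowerIdeal ℓ δ I → card ℓ δ (phiBar ℓ δ I) ≡ card ℓ δ I)
    × ((I J : Subset ℓ δ) → IsLowerIdeal ℓ δ I → IsLowerIdeal ℓ δ J →
         (∀ x → phiBar ℓ δ I x ≡ phiBar ℓ δ J x) → ∀ x → I x ≡ J x)
    × ((U : Subset ℓ δ) → IsFilter ℓ δ U →
         Σ (Subset ℓ δ) (λ I → IsLowerIdeal ℓ δ I × (∀ x → phiBar ℓ δ I x ≡ U x)))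
theorem3p1 (suc k) _ δ δ-positive = phiBar-isFilter , card-phiBar , phiBar-injective , phiBar-surjective
  where
  open PhiBar k δ δ-positive
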